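{- Let $n\ge1$ and $d\ge2$ be integers and $n_1=n/\gcd(n,d)$. Then $d\,\Sigma(n,d)\cong\Sigma(n_1,d)$ and $d\,S(n,d)\cong S(n_1,d)$, where $dG=\{dg: g\in G\}$.
   Context: For $N\ge1$: in $\mathbb{Q}[x]/(x^N-1)$ (exponents mod $N$) put $e_v=x^v-1$, $\epsilon_v=d\,e_v-e_{dv}$; $\mathcal Z_N$ = $\mathbb{Z}$-span of $e_1,\dots,e_{N-1}$, $\mathcal E_{N,d}$ = $\mathbb{Z}$-span of $\epsilon_1,\dots,\epsilon_{N-1}$, $\Sigma(N,d)=\mathcal Z_N/\mathcal E_{N,d}$. With $f_v=dx^v-\sum_{i=0}^{d-1}x^{dv+i}$, $S(N,d)=\mathcal Z_N/\langle f_1,\dots,f_{N-1}\rangle_{\mathbb{Z}}$ (the sandpile group of the generalized de Bruijn graph on $\mathbb{Z}_N$ with arcs $v\to dv+i$, $0\le i\le d-1$), viewed as a subgroup of $\Sigma(N,d)$ via the injection induced by $c\mapsto(x-1)c$. -}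

module Defs where

open import Data.Nat as ℕ using (ℕ; zero; suc; _∸_)
open import Data.Nat.DivMod using (_%_)
open import Data.Fin using (Fin; toℕ)
open import Data.Integer as ℤ using (ℤ; +_; _+_; _*_; _-_; -_)
open import Data.List using (List; []; _∷_; map; upTo; foldr)
open import Data.Bool using (if_then_else_)
open import Relation.Nullary.Decidable using (⌊_⌋)
open import Data.Product using (Σ; ∃; _×_; _,_)
open import Relation.Binary.PropositionalEquality using (_≡_)

-- v mod N (with the harmless convention v mod 0 = v; only N ≥ 1 is used)
_mod_ : ℕ → ℕ → ℕ
v mod zero = v
v mod suc m = v % suc m

-- Elements of ℤ[x]/(x^N - 1) ⊂ ℚ[x]/(x^N - 1): coefficient vectors indexed by
-- the residues 0..N-1 (coefficient of x^i).
Poly : ℕ → Set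
Poly N = Fin N → ℤ

0ₚ : ∀ {N} → Poly N
0ₚ i = + 0

_+ₚ_ : ∀ {N} → Poly N → Poly N → Poly N
(p +ₚ q) i = p i + q i

_-ₚ_ : ∀ {N} → Poly N → Poly N → Poly N
(p -ₚ q) i = p i - q i

_·ₚ_ : ∀ {N} → ℤ → Poly N → Poly N
(a ·ₚ p) i = a * p i

mono : (N v : ℕ) → Poly N
mono N v i = if ⌊ (v mod N) ℕ.≟ toℕ i ⌋ then + 1 else + 0

e : (N v : ℕ) → Poly N
e N v = mono N v -ₚ mono N 0

ε : (N d v : ℕ) → Poly N
ε N d v = ((+ d) ·ₚ e N v) -ₚ e N (d ℕ.* v)

sumₚ : ∀ {N} → List (Poly N) → Poly N
sumₚ = foldr _+ₚ_ 0ₚ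

f : (N d v : ℕ) → Poly N
f N d v = ((+ d) ·ₚ mono N v) -ₚ sumₚ (map (λ i → mono N (d ℕ.* v ℕ.+ i)) (upTo d))

indices : ℕ → List ℕ
indices N = map suc (upTo (N ∸ 1))

lin : (N : ℕ) → (ℕ → Poly N) → (ℕ → ℤ) → Poly N
lin N g c = sumₚ (map (λ v → c v ·ₚ g v) (indices N))

_≐_ : ∀ {N} → Poly N → Poly N → Set
p ≐ q = ∀ i → p i ≡ q i

-- Elements of 𝒵_N are represented by their coordinates c (c_v for v = 1..N-1)
-- with respect to e_1, …, e_{N-1}; the element itself is lin N (e N) c.
Coeffs : Set
Coeffs = ℕ → ℤ

_⊕_ : Coeffs → Coeffs → Coeffs
(c ⊕ c') v = c v + c' v

_⊙_ : ℕ → Coeffs → Coeffs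
(k ⊙ c) v = (+ k) * c v

InSpan : (N : ℕ) → (ℕ → Poly N) → Poly N → Set
InSpan N g p = ∃ λ (k : ℕ → ℤ) → p ≐ lin N g k

-- equality in Σ(N,d) = 𝒵_N / ℰ_{N,d}
≈Σ : (N d : ℕ) → Coeffs → Coeffs → Set
≈Σ N d c c' = InSpan N (ε N d) (lin N (e N) c -ₚ lin N (e N) c')

-- equality in S(N,d) = 𝒵_N / ⟨f_1, …, f_{N-1}⟩
≈S : (N d : ℕ) → Coeffs → Coeffs → Set
≈S N d c c' = InSpan N (f N d) (lin N (e N) c -ₚ lin N (e N) c')

-- Given two quotient groups H = (Coeffs, _≈H_, ⊕) and G = (Coeffs, _≈G_, ⊕),
-- "H ≅ kG": a well-defined, additive, injective map φ : H → G whose image is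
-- exactly the subgroup kG = {k g : g ∈ G}.
IsoOntoMultiple : (Coeffs → Coeffs → Set) → ℕ → (Coeffs → Coeffs → Set) → Set
IsoOntoMultiple _≈H_ k _≈G_ =
  Σ (Coeffs → Coeffs) λ φ →
      (∀ a a' → a ≈H a' → φ a ≈G φ a')
    × (∀ a a' → φ (a ⊕ a') ≈G (φ a ⊕ φ a'))
    × (∀ a a' → φ a ≈G φ a' → a ≈H a')
    × (∀ a → ∃ λ g → φ a ≈G (k ⊙ g))
    × (∀ g → ∃ λ a → φ a ≈G (k ⊙ g))

module Submission where

-- Elements of ℤ[x]/(x^K - 1) are functions P : ℕ → ℤ read on [0,K) (Elt);
-- the basic operation is the push-forward
--   push A K h P = Σ_{u<A} P(u) x^{h(u) mod K}.
-- Put M = n₁, N = n.  As gcd(M, d/gcd(n,d)) = 1, N ∣ d·M and u ↦ d·u mod N is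
-- injective on [0,M) (gcd-arithmetic), so ι = push M N (d·_) is injective.
--  * Σ: ℰ_{K,d} = (d - F)𝒵_K with F = Frob = push K K (d·_) (span-d-Frob).
--    φ(a) = ι a, and injectivity rests on the descent lemma
--    ι w = (d - F) q  ⇒  q = ι b, w = (d - F) b   (Comparison.Descent).
--  * S: ⟨f_v⟩ is the image of L = d - Spread on all of ℤ[C_K] (span-L), where
--    Spread P = Σ_{t<d} x^t F P.  φ(a) = Spread_{M→N} a; for injectivity the
--    difference operator Δ = x - 1 turns Spread into F (Δ-Spread), the descent
--    lemma applies, and integration (integrate, Δ-kernel-aug) lifts back.
--  In both cases φ(a) ≡ d·(a read on level N), and every d·g is hit.
-- Order of the file: finite sums; residue arithmetic; the group ring and
-- push-forwards; spans; the relations ε and f; the operator Δ; translation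
-- from the statement's definitions and the packaging record MultipleIso;
-- the comparison of levels M and N; the theorem.

open import Defs
open import Data.Nat as ℕ using (ℕ; zero; suc; _∸_; _<_; _≤_; z≤n; s≤s; NonZero)
open import Data.Nat.Properties as ℕP using ()
open import Data.Nat.DivMod using (_/_; _%_; m%n<n; m%n%n≡m%n; m<n⇒m%n≡m; n%n≡0; [m+kn]%n≡m%n; m≡m%n+[m/n]*n; %-distribˡ-+)
open import Data.Nat.Divisibility using (_∣_; divides; ∣m+n∣m⇒∣n; n∣m*n; ∣⇒≤; *-cancelʳ-∣)
open import Data.Nat.Coprimality using (Coprime; coprime-divisor; GCD≡1⇒coprime)
open import Data.Nat.GCD using (gcd; GCD; gcd-GCD; GCD-*; gcd[m,n]∣n; gcd[m,n]≢0)
open import Data.Integer as ℤ using (ℤ; +_; _+_; _*_; _-_; -_)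
open import Data.Integer.Properties as ℤP using ()
open import Data.Fin using (Fin; toℕ; fromℕ<)
open import Data.Fin.Properties using (toℕ-fromℕ<; toℕ<n; any?)
open import Data.List using (map; upTo; applyUpTo)
open import Data.List.Properties using (map-∘)
open import Data.Bool using (if_then_else_)
open import Data.Product using (Σ-syntax; _,_; proj₁; proj₂; _×_)
open import Data.Sum using (_⊎_; inj₁; inj₂)
open import Data.Empty using (⊥-elim)
open import Relation.Nullary using (yes; no)
open import Relation.Nullary.Decidable using (⌊_⌋)
open import Relation.Binary.PropositionalEquality
open import Data.Integer.Tactic.RingSolver using (solve-∀)
import Data.Nat.Tactic.RingSolver as ℕSolver

-- Kronecker delta on ℕ, by recursion so that it computes under suc.
δ : ℕ → ℕ → ℤ
δ zero    zero    = + 1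
δ zero    (suc _) = + 0
δ (suc _) zero    = + 0
δ (suc a) (suc b) = δ a b

δ-refl : ∀ a → δ a a ≡ + 1
δ-refl zero    = refl
δ-refl (suc a) = δ-refl a

δ-≢ : ∀ a b → a ≢ b → δ a b ≡ + 0
δ-≢ zero    zero    a≢b = ⊥-elim (a≢b refl)
δ-≢ zero    (suc b) _   = refl
δ-≢ (suc a) zero    _   = refl
δ-≢ (suc a) (suc b) a≢b = δ-≢ a b (λ a≡b → a≢b (cong suc a≡b))

δ-sym : ∀ a b → δ a b ≡ δ b a
δ-sym zero    zero    = refl
δ-sym zero    (suc b) = refl
δ-sym (suc a) zero    = refl
δ-sym (suc a) (suc b) = δ-sym a b

∑ : ℕ → (ℕ → ℤ) → ℤ
∑ zero    h = + 0
∑ (suc m) h = h 0 + ∑ m (λ j → h (suc j))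

∑-cong : ∀ m {h h' : ℕ → ℤ} → (∀ j → j < m → h j ≡ h' j) → ∑ m h ≡ ∑ m h'
∑-cong zero    eq = refl
∑-cong (suc m) eq = cong₂ _+_ (eq 0 (s≤s z≤n)) (∑-cong m (λ j j<m → eq (suc j) (s≤s j<m)))

∑-ext : ∀ m {h h' : ℕ → ℤ} → (∀ j → h j ≡ h' j) → ∑ m h ≡ ∑ m h'
∑-ext m eq = ∑-cong m (λ j _ → eq j)

∑-0 : ∀ m {h : ℕ → ℤ} → (∀ j → j < m → h j ≡ + 0) → ∑ m h ≡ + 0
∑-0 zero    eq = refl
∑-0 (suc m) eq = cong₂ _+_ (eq 0 (s≤s z≤n)) (∑-0 m (λ j j<m → eq (suc j) (s≤s j<m)))

∑-+ : ∀ m (h h' : ℕ → ℤ) → ∑ m (λ j → h j + h' j) ≡ ∑ m h + ∑ m h'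
∑-+ zero    h h' = refl
∑-+ (suc m) h h' = trans (cong (_+_ (h 0 + h' 0)) (∑-+ m _ _)) (interchange (h 0) (h' 0) (∑ m _) (∑ m _))
  where
  interchange : ∀ a b c d → a + b + (c + d) ≡ a + c + (b + d)
  interchange = solve-∀

∑-*ˡ : ∀ m a (h : ℕ → ℤ) → ∑ m (λ j → a * h j) ≡ a * ∑ m h
∑-*ˡ zero    a h = sym (ℤP.*-zeroʳ a)
∑-*ˡ (suc m) a h = trans (cong (_+_ (a * h 0)) (∑-*ˡ m a _)) (sym (ℤP.*-distribˡ-+ a (h 0) _))

∑-*ʳ : ∀ m a (h : ℕ → ℤ) → ∑ m (λ j → h j * a) ≡ ∑ m h * a
∑-*ʳ m a h = trans (∑-ext m (λ j → ℤP.*-comm (h j) a)) (trans (∑-*ˡ m a h) (ℤP.*-comm a _))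

∑-neg : ∀ m (h : ℕ → ℤ) → ∑ m (λ j → - h j) ≡ - ∑ m h
∑-neg zero    h = refl
∑-neg (suc m) h = trans (cong (_+_ (- h 0)) (∑-neg m _)) (sym (ℤP.neg-distrib-+ (h 0) _))

∑-- : ∀ m (h h' : ℕ → ℤ) → ∑ m (λ j → h j - h' j) ≡ ∑ m h - ∑ m h'
∑-- m h h' = trans (∑-+ m h (λ j → - h' j)) (cong (_+_ (∑ m h)) (∑-neg m h'))

∑-swap : ∀ m k (h : ℕ → ℕ → ℤ) → ∑ m (λ i → ∑ k (h i)) ≡ ∑ k (λ j → ∑ m (λ i → h i j))
∑-swap zero    k h = sym (∑-0 k (λ _ _ → refl))
∑-swap (suc m) k h = trans (cong (_+_ (∑ k (h 0))) (∑-swap m k (λ i → h (suc i))))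
                           (sym (∑-+ k (h 0) (λ j → ∑ m (λ i → h (suc i) j))))

∑-last : ∀ m (h : ℕ → ℤ) → ∑ (suc m) h ≡ ∑ m h + h m
∑-last zero    h = trans (ℤP.+-identityʳ (h 0)) (sym (ℤP.+-identityˡ (h 0)))
∑-last (suc m) h = trans (cong (_+_ (h 0)) (∑-last m (λ j → h (suc j)))) (sym (ℤP.+-assoc (h 0) _ _))

∑-split : ∀ a b (h : ℕ → ℤ) → ∑ (a ℕ.+ b) h ≡ ∑ a h + ∑ b (λ j → h (a ℕ.+ j))
∑-split zero    b h = sym (ℤP.+-identityˡ _)
∑-split (suc a) b h = trans (cong (_+_ (h 0)) (∑-split a b (λ j → h (suc j)))) (sym (ℤP.+-assoc (h 0) _ _))

∑-mul : ∀ a b (h : ℕ → ℤ) → ∑ (a ℕ.* b) h ≡ ∑ a (λ q → ∑ b (λ r → h (q ℕ.* b ℕ.+ r)))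
∑-mul zero    b h = refl
∑-mul (suc a) b h = trans (∑-split b (a ℕ.* b) h)
  (cong (_+_ (∑ b h)) (trans (∑-mul a b (λ j → h (b ℕ.+ j)))
     (∑-ext a (λ q → ∑-ext b (λ r → cong h (sym (ℕP.+-assoc b (q ℕ.* b) r)))))))

∑-const : ∀ m c → ∑ m (λ _ → c) ≡ + m * c
∑-const zero    c = sym (ℤP.*-zeroˡ c)
∑-const (suc m) c = trans (cong (_+_ (c)) (∑-const m c))
  (trans (cong (_+ + m * c) (sym (ℤP.*-identityˡ c))) (sym (ℤP.*-distribʳ-+ c (+ 1) (+ m))))

∑-telescope : ∀ m (h : ℕ → ℤ) → ∑ m (λ t → h (suc t) - h t) ≡ h m - h 0
∑-telescope zero    h = sym (ℤP.+-inverseʳ (h 0))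
∑-telescope (suc m) h = trans (cong (_+_ (h 1 - h 0)) (∑-telescope m (λ j → h (suc j))))
                              (collapse (h 0) (h 1) (h (suc m)))
  where
  collapse : ∀ a b c → b - a + (c - b) ≡ c - a
  collapse = solve-∀

∑-δ : ∀ m j (h : ℕ → ℤ) → j < m → ∑ m (λ u → h u * δ u j) ≡ h j
∑-δ (suc m) zero    h _ = trans (cong₂ _+_ (ℤP.*-identityʳ (h 0)) (∑-0 m (λ u _ → ℤP.*-zeroʳ (h (suc u)))))
                                (ℤP.+-identityʳ (h 0))
∑-δ (suc m) (suc j) h (s≤s j<m) = trans (cong₂ _+_ (ℤP.*-zeroʳ (h 0)) (∑-δ m j (λ u → h (suc u)) j<m))
                                        (ℤP.+-identityˡ _)

∑-δˡ : ∀ m j (h : ℕ → ℤ) → j < m → ∑ m (λ u → δ j u * h u) ≡ h j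
∑-δˡ m j h j<m = trans (∑-ext m (λ u → trans (ℤP.*-comm (δ j u) (h u)) (cong (h u *_) (δ-sym j u))))
                       (∑-δ m j h j<m)

∑-δ1 : ∀ m j → j < m → ∑ m (δ j) ≡ + 1
∑-δ1 m j j<m = trans (∑-ext m (λ u → sym (ℤP.*-identityʳ (δ j u)))) (∑-δˡ m j (λ _ → + 1) j<m)

-- Residue arithmetic.  Exponents are always reduced with _%_; these are the
-- compatibilities between reduction and the maps u ↦ d·u + t used below.

%-+-absorbˡ : ∀ x t N .{{_ : NonZero N}} → (x % N ℕ.+ t) % N ≡ (x ℕ.+ t) % N
%-+-absorbˡ x t N = begin
  (x % N ℕ.+ t) % N           ≡⟨ %-distribˡ-+ (x % N) t N ⟩
  (x % N % N ℕ.+ t % N) % N   ≡⟨ cong (λ y → (y ℕ.+ t % N) % N) (m%n%n≡m%n x N) ⟩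
  (x % N ℕ.+ t % N) % N       ≡⟨ %-distribˡ-+ x t N ⟨
  (x ℕ.+ t) % N               ∎
  where open ≡-Reasoning

*-%-compat : ∀ d x M N .{{_ : NonZero M}} .{{_ : NonZero N}} → N ∣ d ℕ.* M →
             (d ℕ.* (x % M)) % N ≡ (d ℕ.* x) % N
*-%-compat d x M N (divides q dM≡qN) = sym (begin
  (d ℕ.* x) % N                                      ≡⟨ cong (λ y → (d ℕ.* y) % N) (m≡m%n+[m/n]*n x M) ⟩
  (d ℕ.* (x % M ℕ.+ x / M ℕ.* M)) % N                ≡⟨ cong (_% N) (expand d (x % M) (x / M) M) ⟩
  (d ℕ.* (x % M) ℕ.+ x / M ℕ.* (d ℕ.* M)) % N        ≡⟨ cong (λ y → (d ℕ.* (x % M) ℕ.+ x / M ℕ.* y) % N) dM≡qN ⟩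
  (d ℕ.* (x % M) ℕ.+ x / M ℕ.* (q ℕ.* N)) % N        ≡⟨ cong (λ y → (d ℕ.* (x % M) ℕ.+ y) % N) (sym (ℕP.*-assoc (x / M) q N)) ⟩
  (d ℕ.* (x % M) ℕ.+ x / M ℕ.* q ℕ.* N) % N          ≡⟨ [m+kn]%n≡m%n (d ℕ.* (x % M)) (x / M ℕ.* q) N ⟩
  (d ℕ.* (x % M)) % N                                ∎)
  where
  open ≡-Reasoning
  expand : ∀ d r k M → d ℕ.* (r ℕ.+ k ℕ.* M) ≡ d ℕ.* r ℕ.+ k ℕ.* (d ℕ.* M)
  expand = ℕSolver.solve-∀

affine-%-compat : ∀ d x t M N .{{_ : NonZero M}} .{{_ : NonZero N}} → N ∣ d ℕ.* M →
                  (d ℕ.* (x % M) ℕ.+ t) % N ≡ (d ℕ.* x ℕ.+ t) % N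
affine-%-compat d x t M N N∣dM = begin
  (d ℕ.* (x % M) ℕ.+ t) % N         ≡⟨ %-+-absorbˡ (d ℕ.* (x % M)) t N ⟨
  ((d ℕ.* (x % M)) % N ℕ.+ t) % N   ≡⟨ cong (λ y → (y ℕ.+ t) % N) (*-%-compat d x M N N∣dM) ⟩
  ((d ℕ.* x) % N ℕ.+ t) % N         ≡⟨ %-+-absorbˡ (d ℕ.* x) t N ⟩
  (d ℕ.* x ℕ.+ t) % N               ∎
  where open ≡-Reasoning

%-≡⇒∣ : ∀ a b N .{{_ : NonZero N}} → (a ℕ.+ b) % N ≡ a % N → N ∣ b
%-≡⇒∣ a b N eq = ∣m+n∣m⇒∣n (divides ((a ℕ.+ b) / N) quotients) (n∣m*n (a / N))
  where
  open ≡-Reasoning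
  quotients : a / N ℕ.* N ℕ.+ b ≡ (a ℕ.+ b) / N ℕ.* N
  quotients = ℕP.+-cancelˡ-≡ (a % N) _ _ (begin
    a % N ℕ.+ (a / N ℕ.* N ℕ.+ b)     ≡⟨ ℕP.+-assoc (a % N) _ b ⟨
    a % N ℕ.+ a / N ℕ.* N ℕ.+ b       ≡⟨ cong (ℕ._+ b) (m≡m%n+[m/n]*n a N) ⟨
    a ℕ.+ b                           ≡⟨ m≡m%n+[m/n]*n (a ℕ.+ b) N ⟩
    (a ℕ.+ b) % N ℕ.+ (a ℕ.+ b) / N ℕ.* N ≡⟨ cong (ℕ._+ (a ℕ.+ b) / N ℕ.* N) eq ⟩
    a % N ℕ.+ (a ℕ.+ b) / N ℕ.* N     ∎)

module _ {M N g d' : ℕ} .{{_ : NonZero N}} .{{_ : NonZero g}}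
         (N≡Mg : N ≡ M ℕ.* g) (coprime : Coprime M d') where

  private
    small-multiple : ∀ t → t < M → N ∣ (d' ℕ.* g) ℕ.* t → t ≡ 0
    small-multiple zero    _   _   = refl
    small-multiple (suc t) t<M N∣ = ⊥-elim (ℕP.<⇒≱ t<M (∣⇒≤ M∣t))
      where
      regroup : ∀ d' g t → (d' ℕ.* g) ℕ.* t ≡ (d' ℕ.* t) ℕ.* g
      regroup = ℕSolver.solve-∀
      M∣t : M ∣ suc t
      M∣t = coprime-divisor coprime (*-cancelʳ-∣ g (subst₂ _∣_ N≡Mg (regroup d' g (suc t)) N∣))

    injective-≤ : ∀ u u' → u ≤ u' → u' < M →
                  ((d' ℕ.* g) ℕ.* u) % N ≡ ((d' ℕ.* g) ℕ.* u') % N → u ≡ u'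
    injective-≤ u u' u≤u' u'<M eq = begin
      u               ≡⟨ ℕP.+-identityʳ u ⟨
      u ℕ.+ 0         ≡⟨ cong (u ℕ.+_) t≡0 ⟨
      u ℕ.+ (u' ∸ u)  ≡⟨ ℕP.m+[n∸m]≡n u≤u' ⟩
      u'              ∎
      where
      open ≡-Reasoning
      D : ℕ
      D = d' ℕ.* g
      D·u'≡ : D ℕ.* u ℕ.+ D ℕ.* (u' ∸ u) ≡ D ℕ.* u'
      D·u'≡ = trans (sym (ℕP.*-distribˡ-+ D u (u' ∸ u))) (cong (D ℕ.*_) (ℕP.m+[n∸m]≡n u≤u'))
      t≡0 : u' ∸ u ≡ 0
      t≡0 = small-multiple (u' ∸ u) (ℕP.≤-<-trans (ℕP.m∸n≤m u' u) u'<M)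
              (%-≡⇒∣ (D ℕ.* u) (D ℕ.* (u' ∸ u)) N (trans (cong (_% N) D·u'≡) (sym eq)))

  ×d-injective : ∀ u u' → u < M → u' < M →
                 ((d' ℕ.* g) ℕ.* u) % N ≡ ((d' ℕ.* g) ℕ.* u') % N → u ≡ u'
  ×d-injective u u' u<M u'<M eq with ℕP.≤-total u u'
  ... | inj₁ u≤u' = injective-≤ u u' u≤u' u'<M eq
  ... | inj₂ u'≤u = sym (injective-≤ u' u u'≤u u<M (sym eq))

gcd-arithmetic : ∀ n₀ d₁ M → M ℕ.* gcd (suc n₀) (suc d₁) ≡ suc n₀ →
  suc n₀ ∣ suc d₁ ℕ.* M ×
  (∀ u u' → u < M → u' < M → (suc d₁ ℕ.* u) % suc n₀ ≡ (suc d₁ ℕ.* u') % suc n₀ → u ≡ u')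
gcd-arithmetic n₀ d₁ M Mg≡N = N∣dM , d·-injective
  where
  N d g d' : ℕ
  N = suc n₀
  d = suc d₁
  g = gcd N d
  d' = _∣_.quotient (gcd[m,n]∣n N d)
  instance
    g≢0 : NonZero g
    g≢0 = ℕ.≢-nonZero (gcd[m,n]≢0 N d (inj₁ (λ ())))
  d≡d'g : d ≡ d' ℕ.* g
  d≡d'g = _∣_.equality (gcd[m,n]∣n N d)
  N∣dM : N ∣ d ℕ.* M
  N∣dM = divides d' (begin
    d ℕ.* M            ≡⟨ cong (ℕ._* M) d≡d'g ⟩
    d' ℕ.* g ℕ.* M     ≡⟨ ℕP.*-assoc d' g M ⟩
    d' ℕ.* (g ℕ.* M)   ≡⟨ cong (d' ℕ.*_) (trans (ℕP.*-comm g M) Mg≡N) ⟩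
    d' ℕ.* N           ∎)
    where open ≡-Reasoning
  -- dividing gcd(N, d) = g out of N = M·g and d = d'·g leaves gcd(M, d') = 1
  coprime : Coprime M d'
  coprime = GCD≡1⇒coprime (GCD-* (subst₂ (λ x y → GCD x y (1 ℕ.* g)) (sym Mg≡N) d≡d'g
                                    (subst (GCD N d) (sym (ℕP.*-identityˡ g)) (gcd-GCD N d))))
  d·-injective : ∀ u u' → u < M → u' < M → (d ℕ.* u) % N ≡ (d ℕ.* u') % N → u ≡ u'
  d·-injective u u' u<M u'<M du≡du' = ×d-injective (sym Mg≡N) coprime u u' u<M u'<M
    (subst (λ z → (z ℕ.* u) % N ≡ (z ℕ.* u') % N) d≡d'g du≡du')

-- The group ring ℤ[x]/(x^K - 1).  An element is a function P : ℕ → ℤ read on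
-- the residues [0, K) (P j = coefficient of x^j); values outside are ignored.
Elt : Set
Elt = ℕ → ℤ

-- agreement on [0, K), the equality of ℤ[x]/(x^K - 1)
_≡[_]_ : Elt → ℕ → Elt → Set
P ≡[ K ] Q = ∀ j → j < K → P j ≡ Q j

X : (K : ℕ) .{{_ : NonZero K}} → ℕ → Elt
X K v j = δ (v % K) j

push : (A K : ℕ) .{{_ : NonZero K}} → (ℕ → ℕ) → Elt → Elt
push A K h P j = ∑ A (λ u → P u * δ (h u % K) j)

elt : (K : ℕ) .{{_ : NonZero K}} → (ℕ → ℤ) → Elt
elt K c j = ∑ (K ∸ 1) (λ u → c (suc u) * (X K (suc u) j - X K 0 j))

module _ (A K : ℕ) .{{_ : NonZero K}} (h : ℕ → ℕ) where

  push-cong : ∀ {P Q : Elt} → P ≡[ A ] Q → ∀ j → push A K h P j ≡ push A K h Q j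
  push-cong P≡Q j = ∑-cong A (λ u u<A → cong (_* δ (h u % K) j) (P≡Q u u<A))

  push-+ : ∀ (P Q : Elt) j → push A K h (λ y → P y + Q y) j ≡ push A K h P j + push A K h Q j
  push-+ P Q j = trans (∑-ext A (λ u → ℤP.*-distribʳ-+ (δ (h u % K) j) (P u) (Q u))) (∑-+ A _ _)

  push-* : ∀ a (P : Elt) j → push A K h (λ y → a * P y) j ≡ a * push A K h P j
  push-* a P j = trans (∑-ext A (λ u → ℤP.*-assoc a (P u) _)) (∑-*ˡ A a _)

  push-- : ∀ (P Q : Elt) j → push A K h (λ y → P y - Q y) j ≡ push A K h P j - push A K h Q j
  push-- P Q j = trans (push-+ P (λ y → - Q y) j) (cong (_+_ (push A K h P j)) negate)
    where
    negate : push A K h (λ y → - Q y) j ≡ - push A K h Q j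
    negate = trans (∑-ext A (λ u → sym (ℤP.neg-distribˡ-* (Q u) _))) (∑-neg A _)

  push-lin : ∀ m (α : ℕ → ℤ) (Q : ℕ → Elt) j →
    push A K h (λ y → ∑ m (λ v → α v * Q v y)) j ≡ ∑ m (λ v → α v * push A K h (Q v) j)
  push-lin m α Q j = begin
    ∑ A (λ u → ∑ m (λ v → α v * Q v u) * δ (h u % K) j)
      ≡⟨ ∑-ext A (λ u → trans (sym (∑-*ʳ m _ _)) (∑-ext m (λ v → ℤP.*-assoc (α v) _ _))) ⟩
    ∑ A (λ u → ∑ m (λ v → α v * (Q v u * δ (h u % K) j)))
      ≡⟨ ∑-swap A m _ ⟩
    ∑ m (λ v → ∑ A (λ u → α v * (Q v u * δ (h u % K) j)))
      ≡⟨ ∑-ext m (λ v → ∑-*ˡ A (α v) _) ⟩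
    ∑ m (λ v → α v * push A K h (Q v) j) ∎
    where open ≡-Reasoning

  push-∑ : ∀ m (Q : ℕ → Elt) j → push A K h (λ y → ∑ m (λ v → Q v y)) j ≡ ∑ m (λ v → push A K h (Q v) j)
  push-∑ m Q j = trans (∑-ext A (λ u → cong (_* δ (h u % K) j) (∑-ext m (λ v → sym (ℤP.*-identityˡ (Q v u))))))
                 (trans (push-lin m (λ _ → + 1) Q j) (∑-ext m (λ v → ℤP.*-identityˡ _)))

  aug-push : ∀ (P : Elt) → ∑ K (push A K h P) ≡ ∑ A P
  aug-push P = begin
    ∑ K (λ j → ∑ A (λ u → P u * δ (h u % K) j)) ≡⟨ ∑-swap K A _ ⟩
    ∑ A (λ u → ∑ K (λ j → P u * δ (h u % K) j)) ≡⟨ ∑-ext A one-term ⟩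
    ∑ A P                                        ∎
    where
    open ≡-Reasoning
    one-term : ∀ u → ∑ K (λ j → P u * δ (h u % K) j) ≡ P u
    one-term u = trans (∑-*ˡ K (P u) _)
                 (trans (cong (P u *_) (∑-δ1 K _ (m%n<n (h u) K))) (ℤP.*-identityʳ (P u)))

push-X : ∀ A K .{{_ : NonZero A}} .{{_ : NonZero K}} h v j →
         push A K h (X A v) j ≡ δ (h (v % A) % K) j
push-X A K h v j = ∑-δˡ A (v % A) (λ u → δ (h u % K) j) (m%n<n v A)

push-map : ∀ A K .{{_ : NonZero K}} h h' (P : Elt) → (∀ u → h u ≡ h' u) → ∀ j → push A K h P j ≡ push A K h' P j
push-map A K h h' P h≡h' j = ∑-ext A (λ u → cong (λ z → P u * δ (z % K) j) (h≡h' u))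

push-comp : ∀ A B K .{{_ : NonZero B}} .{{_ : NonZero K}} h₁ h₂ h₃ (P : Elt) →
  (∀ u → h₂ (h₁ u % B) % K ≡ h₃ u % K) → ∀ j → push B K h₂ (push A B h₁ P) j ≡ push A K h₃ P j
push-comp A B K h₁ h₂ h₃ P composes j = begin
  ∑ B (λ y → ∑ A (λ u → P u * δ (h₁ u % B) y) * δ (h₂ y % K) j)
    ≡⟨ ∑-ext B (λ y → trans (sym (∑-*ʳ A _ _)) (∑-ext A (λ u → ℤP.*-assoc (P u) _ _))) ⟩
  ∑ B (λ y → ∑ A (λ u → P u * (δ (h₁ u % B) y * δ (h₂ y % K) j)))
    ≡⟨ ∑-swap B A _ ⟩
  ∑ A (λ u → ∑ B (λ y → P u * (δ (h₁ u % B) y * δ (h₂ y % K) j)))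
    ≡⟨ ∑-ext A (λ u → trans (∑-*ˡ B (P u) _) (cong (P u *_) (∑-δˡ B (h₁ u % B) (λ y → δ (h₂ y % K) j) (m%n<n (h₁ u) B)))) ⟩
  ∑ A (λ u → P u * δ (h₂ (h₁ u % B) % K) j)
    ≡⟨ ∑-ext A (λ u → cong (λ z → P u * δ z j) (composes u)) ⟩
  push A K h₃ P j ∎
  where open ≡-Reasoning

module _ (K : ℕ) .{{_ : NonZero K}} where

  elt-ext : ∀ (c c' : ℕ → ℤ) → (∀ v → c v ≡ c' v) → ∀ j → elt K c j ≡ elt K c' j
  elt-ext c c' c≡c' j = ∑-ext (K ∸ 1) (λ u → cong (_* _) (c≡c' (suc u)))

  elt-+ : ∀ (c c' : ℕ → ℤ) j → elt K (λ v → c v + c' v) j ≡ elt K c j + elt K c' j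
  elt-+ c c' j = trans (∑-ext (K ∸ 1) (λ u → ℤP.*-distribʳ-+ _ (c (suc u)) (c' (suc u)))) (∑-+ (K ∸ 1) _ _)

  elt-* : ∀ a (c : ℕ → ℤ) j → elt K (λ v → a * c v) j ≡ a * elt K c j
  elt-* a c j = trans (∑-ext (K ∸ 1) (λ u → ℤP.*-assoc a _ _)) (∑-*ˡ (K ∸ 1) a _)

  aug-elt : ∀ c → ∑ K (elt K c) ≡ + 0
  aug-elt c = begin
    ∑ K (λ j → ∑ (K ∸ 1) (λ u → c (suc u) * (X K (suc u) j - X K 0 j))) ≡⟨ ∑-swap K (K ∸ 1) _ ⟩
    ∑ (K ∸ 1) (λ u → ∑ K (λ j → c (suc u) * (X K (suc u) j - X K 0 j))) ≡⟨ ∑-0 (K ∸ 1) (λ u _ → term u) ⟩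
    + 0                                                                 ∎
    where
    open ≡-Reasoning
    aug-X : ∀ v → ∑ K (X K v) ≡ + 1
    aug-X v = ∑-δ1 K (v % K) (m%n<n v K)
    term : ∀ u → ∑ K (λ j → c (suc u) * (X K (suc u) j - X K 0 j)) ≡ + 0
    term u = trans (∑-*ˡ K (c (suc u)) _)
             (trans (cong (c (suc u) *_) (trans (∑-- K _ _) (cong₂ _-_ (aug-X (suc u)) (aug-X 0))))
                    (ℤP.*-zeroʳ (c (suc u))))

elt-self : ∀ m (P : Elt) → ∑ (suc m) P ≡ + 0 → elt (suc m) P ≡[ suc m ] P
elt-self m P aug zero _ = begin
  ∑ m (λ u → P (suc u) * (X (suc m) (suc u) 0 - X (suc m) 0 0))
    ≡⟨ ∑-cong m (λ u u<m → cong (λ z → P (suc u) * (δ z 0 - + 1)) (m<n⇒m%n≡m (s≤s u<m))) ⟩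
  ∑ m (λ u → P (suc u) * - + 1)  ≡⟨ ∑-*ʳ m _ _ ⟩
  ∑ m (λ u → P (suc u)) * - + 1  ≡⟨ ℤP.*-comm _ (- + 1) ⟩
  - + 1 * ∑ m (λ u → P (suc u))  ≡⟨ ℤP.-1*i≡-i _ ⟩
  - ∑ m (λ u → P (suc u))        ≡⟨ cong -_ (first-term (P 0) _ aug) ⟩
  - - P 0                        ≡⟨ ℤP.neg-involutive (P 0) ⟩
  P 0                            ∎
  where
  open ≡-Reasoning
  first-term : ∀ a b → a + b ≡ + 0 → b ≡ - a
  first-term a b a+b≡0 = ℤP.i-j≡0⇒i≡j b (- a)
    (trans (cong (_+_ b) (ℤP.neg-involutive a)) (trans (ℤP.+-comm b a) a+b≡0))
elt-self m P aug (suc j) (s≤s j<m) = begin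
  ∑ m (λ u → P (suc u) * (X (suc m) (suc u) (suc j) - X (suc m) 0 (suc j)))
    ≡⟨ ∑-cong m (λ u u<m → cong (λ z → P (suc u) * (δ z (suc j) - + 0)) (m<n⇒m%n≡m (s≤s u<m))) ⟩
  ∑ m (λ u → P (suc u) * (δ u j - + 0))
    ≡⟨ ∑-ext m (λ u → cong (P (suc u) *_) (ℤP.+-identityʳ (δ u j))) ⟩
  ∑ m (λ u → P (suc u) * δ u j) ≡⟨ ∑-δ m j (λ u → P (suc u)) j<m ⟩
  P (suc j) ∎
  where open ≡-Reasoning

comb : ℕ → (ℕ → Elt) → (ℕ → ℤ) → Elt
comb K G k j = ∑ (K ∸ 1) (λ u → k (suc u) * G (suc u) j)

Span : ℕ → (ℕ → Elt) → Elt → Set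
Span K G P = Σ[ k ∈ (ℕ → ℤ) ] (P ≡[ K ] comb K G k)

_≈[_,_]_ : Elt → ℕ → (ℕ → Elt) → Elt → Set
P ≈[ K , G ] Q = Span K G (λ j → P j - Q j)

module _ {K : ℕ} {G : ℕ → Elt} where

  span-resp : ∀ {P Q : Elt} → P ≡[ K ] Q → Span K G Q → Span K G P
  span-resp P≡Q (k , Q≡) = k , λ j j<K → trans (P≡Q j j<K) (Q≡ j j<K)

  span-0 : Span K G (λ _ → + 0)
  span-0 = (λ _ → + 0) , λ j _ → sym (∑-0 (K ∸ 1) (λ u _ → ℤP.*-zeroˡ (G (suc u) j)))

  span-+ : ∀ {P Q : Elt} → Span K G P → Span K G Q → Span K G (λ j → P j + Q j)
  span-+ (k , P≡) (k' , Q≡) = (λ v → k v + k' v) , λ j j<K →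
    trans (cong₂ _+_ (P≡ j j<K) (Q≡ j j<K))
      (trans (sym (∑-+ (K ∸ 1) _ _)) (∑-ext (K ∸ 1) (λ u → sym (ℤP.*-distribʳ-+ (G (suc u) j) (k (suc u)) (k' (suc u))))))

  span-* : ∀ a {P : Elt} → Span K G P → Span K G (λ j → a * P j)
  span-* a (k , P≡) = (λ v → a * k v) , λ j j<K →
    trans (cong (a *_) (P≡ j j<K))
      (trans (sym (∑-*ˡ (K ∸ 1) a _)) (∑-ext (K ∸ 1) (λ u → sym (ℤP.*-assoc a (k (suc u)) _))))

  span-neg : ∀ {P : Elt} → Span K G P → Span K G (λ j → - P j)
  span-neg s = span-resp (λ j _ → sym (ℤP.-1*i≡-i _)) (span-* (- + 1) s)

  span-∑ : ∀ m (α : ℕ → ℤ) (Q : ℕ → Elt) → (∀ v → v < m → Span K G (Q v)) →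
           Span K G (λ j → ∑ m (λ v → α v * Q v j))
  span-∑ zero    α Q _ = span-0
  span-∑ (suc m) α Q s = span-+ (span-* (α 0) (s 0 (s≤s z≤n)))
                                (span-∑ m (λ v → α (suc v)) (λ v → Q (suc v)) (λ v v<m → s (suc v) (s≤s v<m)))

  span-∑1 : ∀ m (Q : ℕ → Elt) → (∀ v → v < m → Span K G (Q v)) → Span K G (λ j → ∑ m (λ v → Q v j))
  span-∑1 m Q s = span-resp (λ j _ → ∑-ext m (λ v → sym (ℤP.*-identityˡ (Q v j)))) (span-∑ m (λ _ → + 1) Q s)

  ≈-refl : ∀ {P : Elt} → P ≈[ K , G ] P
  ≈-refl {P} = span-resp (λ j _ → ℤP.+-inverseʳ (P j)) span-0

span-periodic : ∀ m (G : ℕ → Elt) → (∀ w → G w ≡[ suc m ] G (w % suc m)) → Span (suc m) G (G 0) →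
                ∀ w → Span (suc m) G (G w)
span-periodic m G periodic G₀ w with w % suc m | periodic w | m%n<n w (suc m)
... | zero  | G≡ | _       = span-resp {G = G} G≡ G₀
... | suc r | G≡ | s≤s r<m = span-resp {G = G} G≡ ((λ v → δ (suc r) v) , λ j _ → sym (∑-δˡ m r (λ u → G (suc u) j) r<m))

-- The relations of Σ(K,d):  ε_v = d(x^v - 1) - (x^{dv} - 1).  With the
-- Frobenius-like map F = push K K (d·_) (x^u ↦ x^{du}) one has ε_v = (d - F) e_v,
-- so ℰ_{K,d} = (d - F) 𝒵_K.
εElt : (K : ℕ) .{{_ : NonZero K}} → ℕ → ℕ → Elt
εElt K d v j = + d * (X K v j - X K 0 j) - (X K (d ℕ.* v) j - X K 0 j)

Frob : (K : ℕ) .{{_ : NonZero K}} → ℕ → Elt → Elt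
Frob K d = push K K (d ℕ.*_)

Frob-elt : ∀ k₀ d c j → Frob (suc k₀) d (elt (suc k₀) c) j ≡
           ∑ k₀ (λ u → c (suc u) * (X (suc k₀) (d ℕ.* suc u) j - X (suc k₀) 0 j))
Frob-elt k₀ d c j =
  trans (push-lin K K (d ℕ.*_) k₀ (λ u → c (suc u)) (λ u y → X K (suc u) y - X K 0 y) j)
        (∑-ext k₀ (λ u → cong (c (suc u) *_)
          (trans (push-- K K (d ℕ.*_) (X K (suc u)) (X K 0) j) (cong₂ _-_ (Frob-X (suc u)) Frob-1))))
  where
  K : ℕ
  K = suc k₀
  Frob-X : ∀ v → Frob K d (X K v) j ≡ X K (d ℕ.* v) j
  Frob-X v = trans (push-X K K (d ℕ.*_) v j) (cong (λ z → δ z j) (*-%-compat d v K K (divides d refl)))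
  Frob-1 : Frob K d (X K 0) j ≡ X K 0 j
  Frob-1 = trans (Frob-X 0) (cong (λ z → X K z j) (ℕP.*-zeroʳ d))

comb-ε : ∀ k₀ d (c : ℕ → ℤ) j → comb (suc k₀) (εElt (suc k₀) d) c j ≡
         + d * elt (suc k₀) c j - Frob (suc k₀) d (elt (suc k₀) c) j
comb-ε k₀ d c j = sym (begin
  + d * elt K c j - Frob K d (elt K c) j
    ≡⟨ cong₂ _-_ (sym (∑-*ˡ k₀ (+ d) _)) (Frob-elt k₀ d c j) ⟩
  ∑ k₀ (λ u → + d * (c (suc u) * (X K (suc u) j - X K 0 j))) - ∑ k₀ (λ u → c (suc u) * (X K (d ℕ.* suc u) j - X K 0 j))
    ≡⟨ sym (∑-- k₀ _ _) ⟩
  ∑ k₀ (λ u → + d * (c (suc u) * (X K (suc u) j - X K 0 j)) - c (suc u) * (X K (d ℕ.* suc u) j - X K 0 j))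
    ≡⟨ ∑-ext k₀ (λ u → factor (+ d) (c (suc u)) (X K (suc u) j) (X K 0 j) (X K (d ℕ.* suc u) j)) ⟩
  comb K (εElt K d) c j ∎)
  where
  open ≡-Reasoning
  K : ℕ
  K = suc k₀
  factor : ∀ D c a z b → D * (c * (a - z)) - c * (b - z) ≡ c * (D * (a - z) - (b - z))
  factor = solve-∀

span-d-Frob : ∀ k₀ d (P : Elt) → ∑ (suc k₀) P ≡ + 0 →
              Span (suc k₀) (εElt (suc k₀) d) (λ j → + d * P j - Frob (suc k₀) d P j)
span-d-Frob k₀ d P aug = P , λ j j<K → sym (trans (comb-ε k₀ d P j)
  (cong₂ _-_ (cong (+ d *_) (elt-self k₀ P aug j j<K))
             (push-cong (suc k₀) (suc k₀) (d ℕ.*_) (elt-self k₀ P aug) j)))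

-- Writing
-- Spread P = Σ_{t<d} x^t · F P, one has Σ_v P(v) f_v = d P - Spread P, so the
-- span of the f_v is the image of L = d - Spread on the whole group ring.
fElt : (K : ℕ) .{{_ : NonZero K}} → ℕ → ℕ → Elt
fElt K d v j = + d * X K v j - ∑ d (λ t → X K (d ℕ.* v ℕ.+ t) j)

Spread : ∀ (d A K : ℕ) .{{_ : NonZero K}} → Elt → Elt
Spread d A K P j = ∑ d (λ t → push A K (λ u → d ℕ.* u ℕ.+ t) P j)

module _ (d A K : ℕ) .{{_ : NonZero K}} where

  Spread-cong : ∀ {P Q : Elt} → P ≡[ A ] Q → ∀ j → Spread d A K P j ≡ Spread d A K Q j
  Spread-cong P≡Q j = ∑-ext d (λ t → push-cong A K (λ u → d ℕ.* u ℕ.+ t) P≡Q j)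

  Spread-+ : ∀ (P Q : Elt) j → Spread d A K (λ y → P y + Q y) j ≡ Spread d A K P j + Spread d A K Q j
  Spread-+ P Q j = trans (∑-ext d (λ t → push-+ A K (λ u → d ℕ.* u ℕ.+ t) P Q j)) (∑-+ d _ _)

  Spread-- : ∀ (P Q : Elt) j → Spread d A K (λ y → P y - Q y) j ≡ Spread d A K P j - Spread d A K Q j
  Spread-- P Q j = trans (∑-ext d (λ t → push-- A K (λ u → d ℕ.* u ℕ.+ t) P Q j)) (∑-- d _ _)

  aug-Spread : ∀ (P : Elt) → ∑ K (Spread d A K P) ≡ + d * ∑ A P
  aug-Spread P = trans (∑-swap K d (λ j t → push A K (λ u → d ℕ.* u ℕ.+ t) P j))
                 (trans (∑-ext d (λ t → aug-push A K (λ u → d ℕ.* u ℕ.+ t) P)) (∑-const d (∑ A P)))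

Spread-reduce : ∀ d A B K .{{_ : NonZero B}} .{{_ : NonZero K}} (P : Elt) → K ∣ d ℕ.* B → ∀ j →
                Spread d B K (push A B (λ u → u) P) j ≡ Spread d A K P j
Spread-reduce d A B K P K∣dB j = ∑-ext d (λ t →
  push-comp A B K (λ u → u) (λ u → d ℕ.* u ℕ.+ t) (λ u → d ℕ.* u ℕ.+ t) P (λ u → affine-%-compat d u t B K K∣dB) j)

X-expand : ∀ k₀ (P : Elt) → (λ j → ∑ (suc k₀) (λ v → P v * X (suc k₀) v j)) ≡[ suc k₀ ] P
X-expand k₀ P j j<K = trans (∑-cong (suc k₀) (λ v v<K → cong (λ z → P v * δ z j) (m<n⇒m%n≡m v<K)))
                            (∑-δ (suc k₀) j P j<K)

comb-f : ∀ k₀ d (P : Elt) → (λ j → + d * P j - Spread d (suc k₀) (suc k₀) P j)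
                              ≡[ suc k₀ ] (λ j → ∑ (suc k₀) (λ v → P v * fElt (suc k₀) d v j))
comb-f k₀ d P j j<K = sym (begin
  ∑ K (λ v → P v * (+ d * X K v j - ∑ d (λ t → X K (d ℕ.* v ℕ.+ t) j)))
    ≡⟨ ∑-ext K distribute ⟩
  ∑ K (λ v → + d * (P v * X K v j) - ∑ d (λ t → P v * X K (d ℕ.* v ℕ.+ t) j))
    ≡⟨ ∑-- K (λ v → + d * (P v * X K v j)) (λ v → ∑ d (λ t → P v * X K (d ℕ.* v ℕ.+ t) j)) ⟩
  ∑ K (λ v → + d * (P v * X K v j)) - ∑ K (λ v → ∑ d (λ t → P v * X K (d ℕ.* v ℕ.+ t) j))
    ≡⟨ cong₂ _-_ (trans (∑-*ˡ K (+ d) (λ v → P v * X K v j)) (cong (+ d *_) (X-expand k₀ P j j<K)))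
                 (∑-swap K d (λ v t → P v * X K (d ℕ.* v ℕ.+ t) j)) ⟩
  + d * P j - Spread d K K P j ∎)
  where
  open ≡-Reasoning
  K : ℕ
  K = suc k₀
  distribute : ∀ v → P v * (+ d * X K v j - ∑ d (λ t → X K (d ℕ.* v ℕ.+ t) j))
                   ≡ + d * (P v * X K v j) - ∑ d (λ t → P v * X K (d ℕ.* v ℕ.+ t) j)
  distribute v = trans (ℤP.*-distribˡ-+ (P v) _ _)
    (cong₂ _+_ (swap-scalar (P v) (+ d) (X K v j))
               (trans (sym (ℤP.neg-distribʳ-* (P v) _)) (cong -_ (sym (∑-*ˡ d (P v) _)))))
    where
    swap-scalar : ∀ p D x → p * (D * x) ≡ D * (p * x)
    swap-scalar = solve-∀

-- Σ_{v<K} f_v = d·𝟙 - d·𝟙 = 0, since the exponents d v + t run over [0, dK)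
f-sum : ∀ k₀ d → (λ j → ∑ (suc k₀) (λ v → fElt (suc k₀) d v j)) ≡[ suc k₀ ] (λ _ → + 0)
f-sum k₀ d j j<K = begin
  ∑ K (λ v → + d * X K v j - ∑ d (λ t → X K (d ℕ.* v ℕ.+ t) j))
    ≡⟨ ∑-- K (λ v → + d * X K v j) (λ v → ∑ d (λ t → X K (d ℕ.* v ℕ.+ t) j)) ⟩
  ∑ K (λ v → + d * X K v j) - ∑ K (λ v → ∑ d (λ t → X K (d ℕ.* v ℕ.+ t) j))
    ≡⟨ cong₂ _-_ (trans (∑-*ˡ K (+ d) (λ v → X K v j)) (cong (+ d *_) one)) all-exponents ⟩
  + d * + 1 - + d * + 1 ≡⟨ ℤP.+-inverseʳ (+ d * + 1) ⟩
  + 0 ∎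
  where
  open ≡-Reasoning
  K : ℕ
  K = suc k₀
  one : ∑ K (λ v → X K v j) ≡ + 1
  one = trans (∑-ext K (λ v → sym (ℤP.*-identityˡ (X K v j)))) (X-expand k₀ (λ _ → + 1) j j<K)
  all-exponents : ∑ K (λ v → ∑ d (λ t → X K (d ℕ.* v ℕ.+ t) j)) ≡ + d * + 1
  all-exponents = begin
    ∑ K (λ v → ∑ d (λ t → X K (d ℕ.* v ℕ.+ t) j))
      ≡⟨ ∑-ext K (λ v → ∑-ext d (λ t → cong (λ z → X K (z ℕ.+ t) j) (ℕP.*-comm d v))) ⟩
    ∑ K (λ v → ∑ d (λ t → X K (v ℕ.* d ℕ.+ t) j)) ≡⟨ ∑-mul K d (λ m → X K m j) ⟨
    ∑ (K ℕ.* d) (λ m → X K m j)                   ≡⟨ cong (λ z → ∑ z (λ m → X K m j)) (ℕP.*-comm K d) ⟩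
    ∑ (d ℕ.* K) (λ m → X K m j)                   ≡⟨ ∑-mul d K (λ m → X K m j) ⟩
    ∑ d (λ q → ∑ K (λ r → X K (q ℕ.* K ℕ.+ r) j))
      ≡⟨ ∑-ext d (λ q → ∑-ext K (λ r → cong (λ z → δ z j)
           (trans (cong (_% K) (ℕP.+-comm (q ℕ.* K) r)) ([m+kn]%n≡m%n r q K)))) ⟩
    ∑ d (λ q → ∑ K (λ r → X K r j))               ≡⟨ ∑-ext d (λ _ → one) ⟩
    ∑ d (λ q → + 1)                               ≡⟨ ∑-const d (+ 1) ⟩
    + d * + 1 ∎

f-periodic : ∀ k₀ d w → fElt (suc k₀) d w ≡[ suc k₀ ] fElt (suc k₀) d (w % suc k₀)
f-periodic k₀ d w j _ = cong₂ _-_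
  (cong (λ z → + d * δ z j) (sym (m%n%n≡m%n w K)))
  (∑-ext d (λ t → cong (λ z → δ z j) (sym (affine-%-compat d w t K K (divides d refl)))))
  where K = suc k₀

-- every f_w, including f_0 = -(f_1 + … + f_{K-1}), lies in ⟨f_1, …, f_{K-1}⟩
span-f : ∀ k₀ d w → Span (suc k₀) (fElt (suc k₀) d) (fElt (suc k₀) d w)
span-f k₀ d = span-periodic k₀ (fElt K d) (f-periodic k₀ d) ((λ _ → - + 1) , f₀)
  where
  open ≡-Reasoning
  K : ℕ
  K = suc k₀
  f₀ : fElt K d 0 ≡[ K ] comb K (fElt K d) (λ _ → - + 1)
  f₀ j j<K = begin
    fElt K d 0 j                                  ≡⟨ ℤP.i-j≡0⇒i≡j _ _ (trans (cong (_+_ (fElt K d 0 j)) (ℤP.neg-involutive _)) (f-sum k₀ d j j<K)) ⟩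
    - ∑ k₀ (λ u → fElt K d (suc u) j)             ≡⟨ ℤP.-1*i≡-i _ ⟨
    - + 1 * ∑ k₀ (λ u → fElt K d (suc u) j)       ≡⟨ ∑-*ˡ k₀ (- + 1) _ ⟨
    comb K (fElt K d) (λ _ → - + 1) j             ∎

span-L : ∀ k₀ d (P : Elt) → Span (suc k₀) (fElt (suc k₀) d) (λ j → + d * P j - Spread d (suc k₀) (suc k₀) P j)
span-L k₀ d P = span-resp {G = fElt (suc k₀) d} (comb-f k₀ d P)
                  (span-∑ {G = fElt (suc k₀) d} (suc k₀) P (fElt (suc k₀) d) (λ v _ → span-f k₀ d v))

-- Multiplication by x and the difference operator Δ = x - 1.  Δ turns Spread
-- into F (x^d - 1 = (x - 1) Σ_{t<d} x^t), and on ℤ[x]/(x^K - 1) its kernel is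
-- the constants and its image is the augmentation-zero part.
Shift : ∀ K .{{_ : NonZero K}} → Elt → Elt
Shift K = push K K suc

Δ : ∀ K .{{_ : NonZero K}} → Elt → Elt
Δ K P j = Shift K P j - P j

Δ-- : ∀ K .{{_ : NonZero K}} (P Q : Elt) j → Δ K (λ y → P y - Q y) j ≡ Δ K P j - Δ K Q j
Δ-- K P Q j = trans (cong (_- (P j - Q j)) (push-- K K suc P Q j)) (regroup (Shift K P j) (Shift K Q j) (P j) (Q j))
  where
  regroup : ∀ a b c e → a - b - (c - e) ≡ a - c - (b - e)
  regroup = solve-∀

Δ-* : ∀ K .{{_ : NonZero K}} a (P : Elt) j → Δ K (λ y → a * P y) j ≡ a * Δ K P j
Δ-* K a P j = trans (cong (_- a * P j) (push-* K K suc a P j)) (distrib a (Shift K P j) (P j))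
  where
  distrib : ∀ a x y → a * x - a * y ≡ a * (x - y)
  distrib = solve-∀

Δ-cong : ∀ K .{{_ : NonZero K}} {P Q : Elt} → P ≡[ K ] Q → Δ K P ≡[ K ] Δ K Q
Δ-cong K P≡Q j j<K = cong₂ _-_ (push-cong K K suc P≡Q j) (P≡Q j j<K)

aug-Δ : ∀ K .{{_ : NonZero K}} (P : Elt) → ∑ K (Δ K P) ≡ + 0
aug-Δ K P = trans (∑-- K (Shift K P) P) (trans (cong (_- ∑ K P) (aug-push K K suc P)) (ℤP.+-inverseʳ (∑ K P)))

-- Δ (Spread P) = F (Δ P):  the d shifted copies telescope
Δ-Spread : ∀ d A K .{{_ : NonZero A}} .{{_ : NonZero K}} → K ∣ d ℕ.* A → ∀ (P : Elt) j →
           Δ K (Spread d A K P) j ≡ push A K (d ℕ.*_) (Δ A P) j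
Δ-Spread d A K K∣dA P j = begin
  Shift K (Spread d A K P) j - Spread d A K P j
    ≡⟨ cong (_- Spread d A K P j) (trans (push-∑ K K suc d _ j) (∑-ext d shift-term)) ⟩
  ∑ d (λ t → h (suc t)) - ∑ d h    ≡⟨ ∑-- d _ _ ⟨
  ∑ d (λ t → h (suc t) - h t)      ≡⟨ ∑-telescope d h ⟩
  h d - h 0                        ≡⟨ cong₂ _-_ (sym last-copy) (push-map A K _ _ P (λ u → ℕP.+-identityʳ (d ℕ.* u)) j) ⟩
  push A K (d ℕ.*_) (Shift A P) j - push A K (d ℕ.*_) P j ≡⟨ push-- A K (d ℕ.*_) (Shift A P) P j ⟨
  push A K (d ℕ.*_) (Δ A P) j      ∎
  where
  open ≡-Reasoning
  h : ℕ → ℤ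
  h t = push A K (λ u → d ℕ.* u ℕ.+ t) P j
  suc-%-compat : ∀ x → suc (x % K) % K ≡ suc x % K
  suc-%-compat x = trans (cong (_% K) (ℕP.+-comm 1 (x % K))) (trans (%-+-absorbˡ x 1 K) (cong (_% K) (ℕP.+-comm x 1)))
  shift-term : ∀ t → Shift K (push A K (λ u → d ℕ.* u ℕ.+ t) P) j ≡ h (suc t)
  shift-term t = push-comp A K K (λ u → d ℕ.* u ℕ.+ t) suc (λ u → d ℕ.* u ℕ.+ suc t) P
    (λ u → trans (suc-%-compat (d ℕ.* u ℕ.+ t)) (cong (_% K) (sym (ℕP.+-suc (d ℕ.* u) t)))) j
  last-copy : push A K (d ℕ.*_) (Shift A P) j ≡ h d
  last-copy = push-comp A A K suc (d ℕ.*_) (λ u → d ℕ.* u ℕ.+ d) P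
    (λ u → trans (*-%-compat d (suc u) A K K∣dA) (cong (_% K) (trans (ℕP.*-suc d u) (ℕP.+-comm d (d ℕ.* u))))) j

Δ-L : ∀ k₀ d (P : Elt) j → Δ (suc k₀) (λ y → + d * P y - Spread d (suc k₀) (suc k₀) P y) j
                           ≡ + d * Δ (suc k₀) P j - Frob (suc k₀) d (Δ (suc k₀) P) j
Δ-L k₀ d P j = trans (Δ-- K (λ y → + d * P y) (Spread d K K P) j)
                     (cong₂ _-_ (Δ-* K (+ d) P j) (Δ-Spread d K K (divides d refl) P j))
  where K = suc k₀

Shift-0 : ∀ k₀ (P : Elt) → Shift (suc k₀) P 0 ≡ P k₀
Shift-0 k₀ P = begin
  ∑ (suc k₀) (λ y → P y * δ (suc y % suc k₀) 0)       ≡⟨ ∑-last k₀ (λ y → P y * δ (suc y % suc k₀) 0) ⟩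
  ∑ k₀ (λ y → P y * δ (suc y % suc k₀) 0) + P k₀ * δ (suc k₀ % suc k₀) 0
    ≡⟨ cong₂ _+_ (∑-0 k₀ (λ y y<k → trans (cong (λ z → P y * δ z 0) (m<n⇒m%n≡m (s≤s y<k))) (ℤP.*-zeroʳ (P y))))
                 (trans (cong (λ z → P k₀ * δ z 0) (n%n≡0 (suc k₀))) (ℤP.*-identityʳ (P k₀))) ⟩
  + 0 + P k₀                                          ≡⟨ ℤP.+-identityˡ (P k₀) ⟩
  P k₀                                                ∎
  where open ≡-Reasoning

Shift-suc : ∀ k₀ (P : Elt) j → suc j < suc k₀ → Shift (suc k₀) P (suc j) ≡ P j
Shift-suc k₀ P j (s≤s j<k) = begin
  ∑ (suc k₀) (λ y → P y * δ (suc y % suc k₀) (suc j))  ≡⟨ ∑-last k₀ (λ y → P y * δ (suc y % suc k₀) (suc j)) ⟩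
  ∑ k₀ (λ y → P y * δ (suc y % suc k₀) (suc j)) + P k₀ * δ (suc k₀ % suc k₀) (suc j)
    ≡⟨ cong₂ _+_ (trans (∑-cong k₀ (λ y y<k → cong (λ z → P y * δ z (suc j)) (m<n⇒m%n≡m (s≤s y<k)))) (∑-δ k₀ j P j<k))
                 (trans (cong (λ z → P k₀ * δ z (suc j)) (n%n≡0 (suc k₀))) (ℤP.*-zeroʳ (P k₀))) ⟩
  P j + + 0                                            ≡⟨ ℤP.+-identityʳ (P j) ⟩
  P j                                                  ∎
  where open ≡-Reasoning

Δ-kernel : ∀ k₀ (R : Elt) → Δ (suc k₀) R ≡[ suc k₀ ] (λ _ → + 0) → R ≡[ suc k₀ ] (λ _ → R 0)
Δ-kernel k₀ R ΔR≡0 zero    _  = refl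
Δ-kernel k₀ R ΔR≡0 (suc j) lt = trans (sym (ℤP.i-j≡0⇒i≡j (R j) (R (suc j)) step))
                                      (Δ-kernel k₀ R ΔR≡0 j (ℕP.<-trans (ℕP.n<1+n j) lt))
  where
  step : R j - R (suc j) ≡ + 0
  step = trans (cong (_- R (suc j)) (sym (Shift-suc k₀ R j lt))) (ΔR≡0 (suc j) lt)

Δ-kernel-aug : ∀ k₀ (R : Elt) → Δ (suc k₀) R ≡[ suc k₀ ] (λ _ → + 0) → ∑ (suc k₀) R ≡ + 0 →
               R ≡[ suc k₀ ] (λ _ → + 0)
Δ-kernel-aug k₀ R ΔR≡0 aug j j<K = trans (Δ-kernel k₀ R ΔR≡0 j j<K) R0≡0
  where
  open ≡-Reasoning
  K : ℕ
  K = suc k₀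
  R0≡0 : R 0 ≡ + 0
  R0≡0 = ℤP.*-cancelˡ-≡ (+ K) (R 0) (+ 0) (begin
    + K * R 0       ≡⟨ ∑-const K (R 0) ⟨
    ∑ K (λ _ → R 0) ≡⟨ ∑-cong K (Δ-kernel k₀ R ΔR≡0) ⟨
    ∑ K R           ≡⟨ aug ⟩
    + 0             ≡⟨ ℤP.*-zeroʳ (+ K) ⟨
    + K * + 0       ∎)

-- im Δ ⊇ augmentation zero:  b = Δ B  for  B(u) = -(b 0 + … + b u)
integrate : ∀ k₀ (b : Elt) → ∑ (suc k₀) b ≡ + 0 → Δ (suc k₀) (λ u → - ∑ (suc u) b) ≡[ suc k₀ ] b
integrate k₀ b aug zero _ = begin
  Shift (suc k₀) B 0 - B 0        ≡⟨ cong (_- B 0) (Shift-0 k₀ B) ⟩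
  - ∑ (suc k₀) b - B 0            ≡⟨ cong (λ z → - z - B 0) aug ⟩
  + 0 - (- (b 0 + + 0))           ≡⟨ cancel (b 0) ⟩
  b 0                             ∎
  where
  open ≡-Reasoning
  B : Elt
  B = λ u → - ∑ (suc u) b
  cancel : ∀ x → + 0 - (- (x + + 0)) ≡ x
  cancel = solve-∀
integrate k₀ b aug (suc j) lt = begin
  Shift (suc k₀) B (suc j) - B (suc j)  ≡⟨ cong (_- B (suc j)) (Shift-suc k₀ B j lt) ⟩
  - ∑ (suc j) b - (- ∑ (suc (suc j)) b) ≡⟨ cong (λ z → - ∑ (suc j) b - (- z)) (∑-last (suc j) b) ⟩
  - ∑ (suc j) b - (- (∑ (suc j) b + b (suc j))) ≡⟨ cancel (∑ (suc j) b) (b (suc j)) ⟩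
  b (suc j)                             ∎
  where
  open ≡-Reasoning
  B : Elt
  B = λ u → - ∑ (suc u) b
  cancel : ∀ s x → - s - (- (s + x)) ≡ x
  cancel = solve-∀

-- Translation from the list-and-Fin based definitions of the statement.
δ-if : ∀ a b → (if ⌊ a ℕ.≟ b ⌋ then + 1 else + 0) ≡ δ a b
δ-if a b with a ℕ.≟ b
... | yes refl = sym (δ-refl a)
... | no  a≢b  = sym (δ-≢ a b a≢b)

sumₚ-∑ : ∀ {N} (F : ℕ → Poly N) m (s : ℕ → ℕ) i → sumₚ (map F (applyUpTo s m)) i ≡ ∑ m (λ u → F (s u) i)
sumₚ-∑ F zero    s i = refl
sumₚ-∑ F (suc m) s i = cong (_+_ (F (s 0) i)) (sumₚ-∑ F m (λ u → s (suc u)) i)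

lin-comb : ∀ N (g : ℕ → Poly N) (G : ℕ → Elt) → (∀ v i → g v i ≡ G v (toℕ i)) →
           ∀ k i → lin N g k i ≡ comb N G k (toℕ i)
lin-comb N g G g≡G k i = begin
  sumₚ (map (λ v → k v ·ₚ g v) (map suc (upTo (N ∸ 1)))) i
    ≡⟨ cong (λ l → sumₚ l i) (sym (map-∘ (upTo (N ∸ 1)))) ⟩
  sumₚ (map (λ u → k (suc u) ·ₚ g (suc u)) (upTo (N ∸ 1))) i
    ≡⟨ sumₚ-∑ (λ u → k (suc u) ·ₚ g (suc u)) (N ∸ 1) (λ u → u) i ⟩
  ∑ (N ∸ 1) (λ u → k (suc u) * g (suc u) i)
    ≡⟨ ∑-ext (N ∸ 1) (λ u → cong (k (suc u) *_) (g≡G (suc u) i)) ⟩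
  comb N G k (toℕ i) ∎
  where open ≡-Reasoning

module _ (m : ℕ) where
  private
    K : ℕ
    K = suc m

  mono-X : ∀ v (i : Fin K) → mono K v i ≡ X K v (toℕ i)
  mono-X v i = δ-if (v % K) (toℕ i)

  e-X : ∀ v (i : Fin K) → e K v i ≡ X K v (toℕ i) - X K 0 (toℕ i)
  e-X v i = cong₂ _-_ (mono-X v i) (mono-X 0 i)

  ε-εElt : ∀ d v (i : Fin K) → ε K d v i ≡ εElt K d v (toℕ i)
  ε-εElt d v i = cong₂ _-_ (cong (+ d *_) (e-X v i)) (e-X (d ℕ.* v) i)

  f-fElt : ∀ d v (i : Fin K) → f K d v i ≡ fElt K d v (toℕ i)
  f-fElt d v i = cong₂ _-_ (cong (+ d *_) (mono-X v i))
    (trans (sumₚ-∑ (λ t → mono K (d ℕ.* v ℕ.+ t)) d (λ u → u) i) (∑-ext d (λ t → mono-X (d ℕ.* v ℕ.+ t) i)))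

  lin-elt : ∀ c i → lin K (e K) c i ≡ elt K c (toℕ i)
  lin-elt = lin-comb K (e K) (λ v j → X K v j - X K 0 j) e-X

  module _ (g : ℕ → Poly K) (G : ℕ → Elt) (g≡G : ∀ v i → g v i ≡ G v (toℕ i)) where

    to-span : ∀ c c' → InSpan K g (lin K (e K) c -ₚ lin K (e K) c') → elt K c ≈[ K , G ] elt K c'
    to-span c c' (k , in-span) = k , λ j j<K →
      let i = fromℕ< j<K
          i≡j = toℕ-fromℕ< j<K
      in begin
        elt K c j - elt K c' j                                   ≡⟨ cong (λ z → elt K c z - elt K c' z) (sym i≡j) ⟩
        elt K c (toℕ i) - elt K c' (toℕ i)                       ≡⟨ cong₂ _-_ (lin-elt c i) (lin-elt c' i) ⟨
        lin K (e K) c i - lin K (e K) c' i                       ≡⟨ in-span i ⟩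
        lin K g k i                                              ≡⟨ lin-comb K g G g≡G k i ⟩
        comb K G k (toℕ i)                                       ≡⟨ cong (comb K G k) i≡j ⟩
        comb K G k j                                             ∎
      where open ≡-Reasoning

    from-span : ∀ c c' → elt K c ≈[ K , G ] elt K c' → InSpan K g (lin K (e K) c -ₚ lin K (e K) c')
    from-span c c' (k , in-span) = k , λ i →
      trans (cong₂ _-_ (lin-elt c i) (lin-elt c' i))
            (trans (in-span (toℕ i) (toℕ<n i)) (sym (lin-comb K g G g≡G k i)))

record MultipleIso (m n k : ℕ) (GM GN : ℕ → Elt) : Set where
  field
    φ            : Coeffs → Coeffs
    additive     : ∀ a a' v → φ (a ⊕ a') v ≡ φ a v + φ a' v
    well-defined : ∀ a a' → elt (suc m) a ≈[ suc m , GM ] elt (suc m) a' →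
                   elt (suc n) (φ a) ≈[ suc n , GN ] elt (suc n) (φ a')
    injective    : ∀ a a' → elt (suc n) (φ a) ≈[ suc n , GN ] elt (suc n) (φ a') →
                   elt (suc m) a ≈[ suc m , GM ] elt (suc m) a'
    into-k·      : ∀ a → Σ[ g ∈ Coeffs ] elt (suc n) (φ a) ≈[ suc n , GN ] elt (suc n) (k ⊙ g)
    onto-k·      : ∀ g → Σ[ a ∈ Coeffs ] elt (suc n) (φ a) ≈[ suc n , GN ] elt (suc n) (k ⊙ g)

multiple-iso : ∀ m n k (gM : ℕ → Poly (suc m)) (GM : ℕ → Elt) (gN : ℕ → Poly (suc n)) (GN : ℕ → Elt) →
  (∀ v i → gM v i ≡ GM v (toℕ i)) → (∀ v i → gN v i ≡ GN v (toℕ i)) → MultipleIso m n k GM GN →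
  IsoOntoMultiple (λ c c' → InSpan (suc m) gM (lin (suc m) (e (suc m)) c -ₚ lin (suc m) (e (suc m)) c')) k
                  (λ c c' → InSpan (suc n) gN (lin (suc n) (e (suc n)) c -ₚ lin (suc n) (e (suc n)) c'))
multiple-iso m n k gM GM gN GN gM≡GM gN≡GN iso =
    φ
  , (λ a a' a≈a' → fromN (φ a) (φ a') (well-defined a a' (toM a a' a≈a')))
  , (λ a a' → fromN (φ (a ⊕ a')) (φ a ⊕ φ a')
                (span-resp {G = GN} (λ j _ → cong (_-_ (elt (suc n) (φ (a ⊕ a')) j)) (sym (elt-ext (suc n) _ _ (additive a a') j)))
                           (≈-refl {G = GN} {P = elt (suc n) (φ (a ⊕ a'))})))
  , (λ a a' φa≈φa' → fromM a a' (injective a a' (toN (φ a) (φ a') φa≈φa')))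
  , (λ a → let (g , φa≈kg) = into-k· a in g , fromN (φ a) (k ⊙ g) φa≈kg)
  , (λ g → let (a , φa≈kg) = onto-k· g in a , fromN (φ a) (k ⊙ g) φa≈kg)
  where
  open MultipleIso iso
  toM   : ∀ c c' → InSpan (suc m) gM (lin (suc m) (e (suc m)) c -ₚ lin (suc m) (e (suc m)) c') →
          elt (suc m) c ≈[ suc m , GM ] elt (suc m) c'
  toM   = to-span m gM GM gM≡GM
  fromM : ∀ c c' → elt (suc m) c ≈[ suc m , GM ] elt (suc m) c' →
          InSpan (suc m) gM (lin (suc m) (e (suc m)) c -ₚ lin (suc m) (e (suc m)) c')
  fromM = from-span m gM GM gM≡GM
  toN   : ∀ c c' → InSpan (suc n) gN (lin (suc n) (e (suc n)) c -ₚ lin (suc n) (e (suc n)) c') →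
          elt (suc n) c ≈[ suc n , GN ] elt (suc n) c'
  toN   = to-span n gN GN gN≡GN
  fromN : ∀ c c' → elt (suc n) c ≈[ suc n , GN ] elt (suc n) c' →
          InSpan (suc n) gN (lin (suc n) (e (suc n)) c -ₚ lin (suc n) (e (suc n)) c')
  fromN = from-span n gN GN gN≡GN

module Comparison (n₀ m₁ d₁ : ℕ)
                  (N∣dM : suc n₀ ∣ suc d₁ ℕ.* suc m₁)
                  (×d-inj : ∀ u u' → u < suc m₁ → u' < suc m₁ →
                            (suc d₁ ℕ.* u) % suc n₀ ≡ (suc d₁ ℕ.* u') % suc n₀ → u ≡ u') where

  N M d : ℕ
  N = suc n₀
  M = suc m₁
  d = suc d₁

  ι : Elt → Elt
  ι = push M N (d ℕ.*_)

  d·-%-compat : ∀ x → (d ℕ.* (x % M)) % N ≡ (d ℕ.* x) % N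
  d·-%-compat x = *-%-compat d x M N N∣dM

  image? : ∀ j → (Σ[ u ∈ ℕ ] u < M × (d ℕ.* u) % N ≡ j) ⊎ (∀ u → u < M → (d ℕ.* u) % N ≢ j)
  image? j with any? (λ (u : Fin M) → (d ℕ.* toℕ u) % N ℕ.≟ j)
  ... | yes (u , du≡j) = inj₁ (toℕ u , toℕ<n u , du≡j)
  ... | no  none       = inj₂ λ u u<M du≡j →
    none (fromℕ< u<M , subst (λ z → (d ℕ.* z) % N ≡ j) (sym (toℕ-fromℕ< u<M)) du≡j)

  ι-at : ∀ (P : Elt) u₀ → u₀ < M → ι P ((d ℕ.* u₀) % N) ≡ P u₀
  ι-at P u₀ u₀<M = trans (∑-cong M (λ u u<M → cong (P u *_) (δ-image u u<M))) (∑-δ M u₀ P u₀<M)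
    where
    δ-image : ∀ u → u < M → δ ((d ℕ.* u) % N) ((d ℕ.* u₀) % N) ≡ δ u u₀
    δ-image u u<M with u ℕ.≟ u₀
    ... | yes refl = trans (δ-refl ((d ℕ.* u) % N)) (sym (δ-refl u))
    ... | no  u≢u₀ = trans (δ-≢ _ _ (λ eq → u≢u₀ (×d-inj u u₀ u<M u₀<M eq))) (sym (δ-≢ u u₀ u≢u₀))

  push-out : ∀ A (h : ℕ → ℕ) → (∀ y → h y % N ≡ (d ℕ.* (y % M)) % N) →
             ∀ (P : Elt) j → (∀ u → u < M → (d ℕ.* u) % N ≢ j) → push A N h P j ≡ + 0
  push-out A h through P j none = ∑-0 A (λ y _ →
    trans (cong (P y *_) (δ-≢ _ _ (λ hy≡j → none (y % M) (m%n<n y M) (trans (sym (through y)) hy≡j))))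
          (ℤP.*-zeroʳ (P y)))

  Frob-ι : ∀ (P : Elt) j → Frob N d (ι P) j ≡ ι (Frob M d P) j
  Frob-ι P j = trans (push-comp M N N (d ℕ.*_) (d ℕ.*_) (λ u → d ℕ.* (d ℕ.* u)) P
                        (λ u → *-%-compat d (d ℕ.* u) N N (divides d refl)) j)
                     (sym (push-comp M M N (d ℕ.*_) (d ℕ.*_) (λ u → d ℕ.* (d ℕ.* u)) P
                        (λ u → d·-%-compat (d ℕ.* u)) j))

  d·-cancel : ∀ (x : ℤ) → + d * x ≡ + 0 → x ≡ + 0
  d·-cancel x dx≡0 = ℤP.*-cancelˡ-≡ (+ d) x (+ 0) (trans dx≡0 (sym (ℤP.*-zeroʳ (+ d))))

  module Descent (w q : Elt) (ιw≡ : ι w ≡[ N ] (λ j → + d * q j - Frob N d q j)) where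

    b : Elt
    b u = q ((d ℕ.* u) % N)

    q≡ιb : q ≡[ N ] ι b
    q≡ιb j j<N with image? j
    ... | inj₁ (u₀ , u₀<M , refl) = sym (ι-at b u₀ u₀<M)
    ... | inj₂ none = trans (d·-cancel (q j) dq≡0) (sym (push-out M (d ℕ.*_) (λ u → sym (d·-%-compat u)) b j none))
      where
      open ≡-Reasoning
      dq≡0 : + d * q j ≡ + 0
      dq≡0 = begin
        + d * q j                      ≡⟨ ℤP.+-identityʳ _ ⟨
        + d * q j - + 0                ≡⟨ cong (λ z → + d * q j - z) Fq≡0 ⟨
        + d * q j - Frob N d q j       ≡⟨ ιw≡ j j<N ⟨
        ι w j                          ≡⟨ push-out M (d ℕ.*_) (λ u → sym (d·-%-compat u)) w j none ⟩
        + 0                            ∎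
        where
        Fq≡0 : Frob N d q j ≡ + 0
        Fq≡0 = push-out N (d ℕ.*_) (λ y → sym (d·-%-compat y)) q j none

    w≡ : w ≡[ M ] (λ u → + d * b u - Frob M d b u)
    w≡ u₀ u₀<M = begin
      w u₀                             ≡⟨ ι-at w u₀ u₀<M ⟨
      ι w j₀                           ≡⟨ ιw≡ j₀ (m%n<n (d ℕ.* u₀) N) ⟩
      + d * b u₀ - Frob N d q j₀       ≡⟨ cong (λ z → + d * b u₀ - z) (push-cong N N (d ℕ.*_) q≡ιb j₀) ⟩
      + d * b u₀ - Frob N d (ι b) j₀   ≡⟨ cong (λ z → + d * b u₀ - z) (trans (Frob-ι b j₀) (ι-at (Frob M d b) u₀ u₀<M)) ⟩
      + d * b u₀ - Frob M d b u₀       ∎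
      where
      open ≡-Reasoning
      j₀ : ℕ
      j₀ = (d ℕ.* u₀) % N

  lift reduce : Elt → Elt
  lift   = push M N (λ u → u)
  reduce = push N M (λ u → u)

  Frob-lift : ∀ (P : Elt) j → Frob N d (lift P) j ≡ ι P j
  Frob-lift P j = push-comp M N N (λ u → u) (d ℕ.*_) (d ℕ.*_) P (λ u → *-%-compat d u N N (divides d refl)) j

  ι-reduce : ∀ (P : Elt) j → ι (reduce P) j ≡ Frob N d P j
  ι-reduce P j = push-comp N M N (λ u → u) (d ℕ.*_) (d ℕ.*_) P d·-%-compat j

  -- the image statements end with  T g - d g = -(d g - T g)  for T = F or Spread
  swap-sign : ∀ x y → x - y ≡ - (y - x)
  swap-sign = solve-∀

  module Σ-Comparison where

    εN εM : ℕ → Elt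
    εN = εElt N d
    εM = εElt M d

    φ : Coeffs → Coeffs
    φ a = ι (elt M a)

    elt-φ : ∀ a → elt N (φ a) ≡[ N ] φ a
    elt-φ a = elt-self n₀ (φ a) (trans (aug-push M N (d ℕ.*_) (elt M a)) (aug-elt M a))

    φ-diff : ∀ a a' → (λ j → elt N (φ a) j - elt N (φ a') j) ≡[ N ] ι (λ y → elt M a y - elt M a' y)
    φ-diff a a' j j<N = trans (cong₂ _-_ (elt-φ a j j<N) (elt-φ a' j j<N))
                              (sym (push-- M N (d ℕ.*_) (elt M a) (elt M a') j))

    additive : ∀ a a' v → φ (a ⊕ a') v ≡ φ a v + φ a' v
    additive a a' v = trans (push-cong M N (d ℕ.*_) (λ y _ → elt-+ M a a' y) v)
                            (push-+ M N (d ℕ.*_) (elt M a) (elt M a') v)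

    well-defined : ∀ a a' → elt M a ≈[ M , εM ] elt M a' → elt N (φ a) ≈[ N , εN ] elt N (φ a')
    well-defined a a' (k , a≈a') = span-resp {G = εN} φ-diff≡ (span-d-Frob n₀ d (ι E) aug-ιE)
      where
      open ≡-Reasoning
      E : Elt
      E = elt M k
      aug-ιE : ∑ N (ι E) ≡ + 0
      aug-ιE = trans (aug-push M N (d ℕ.*_) E) (aug-elt M k)
      φ-diff≡ : (λ j → elt N (φ a) j - elt N (φ a') j) ≡[ N ] (λ j → + d * ι E j - Frob N d (ι E) j)
      φ-diff≡ j j<N = begin
        elt N (φ a) j - elt N (φ a') j             ≡⟨ φ-diff a a' j j<N ⟩
        ι (λ y → elt M a y - elt M a' y) j         ≡⟨ push-cong M N (d ℕ.*_) (λ y y<M → trans (a≈a' y y<M) (comb-ε m₁ d k y)) j ⟩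
        ι (λ y → + d * E y - Frob M d E y) j       ≡⟨ push-- M N (d ℕ.*_) (λ y → + d * E y) (Frob M d E) j ⟩
        ι (λ y → + d * E y) j - ι (Frob M d E) j   ≡⟨ cong₂ _-_ (push-* M N (d ℕ.*_) (+ d) E j) (sym (Frob-ι E j)) ⟩
        + d * ι E j - Frob N d (ι E) j             ∎

    injective : ∀ a a' → elt N (φ a) ≈[ N , εN ] elt N (φ a') → elt M a ≈[ M , εM ] elt M a'
    injective a a' (k , φa≈φa') = span-resp {G = εM} w≡ (span-d-Frob m₁ d b aug-b)
      where
      open ≡-Reasoning
      w q : Elt
      w y = elt M a y - elt M a' y
      q   = elt N k
      ιw≡ : ι w ≡[ N ] (λ j → + d * q j - Frob N d q j)
      ιw≡ j j<N = trans (sym (φ-diff a a' j j<N)) (trans (φa≈φa' j j<N) (comb-ε n₀ d k j))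
      open Descent w q ιw≡
      aug-b : ∑ M b ≡ + 0
      aug-b = begin
        ∑ M b       ≡⟨ aug-push M N (d ℕ.*_) b ⟨
        ∑ N (ι b)   ≡⟨ ∑-cong N q≡ιb ⟨
        ∑ N q       ≡⟨ aug-elt N k ⟩
        + 0         ∎

    -- φ(a) ≡ d·lift(a): indeed φ = F ∘ lift, and d - F kills the difference
    into-d· : ∀ a → Σ[ g ∈ Coeffs ] elt N (φ a) ≈[ N , εN ] elt N (d ⊙ g)
    into-d· a = g , span-resp {G = εN} φa-dg (span-neg {G = εN} (span-d-Frob n₀ d g aug-g))
      where
      g : Coeffs
      g = lift (elt M a)
      aug-g : ∑ N g ≡ + 0
      aug-g = trans (aug-push M N (λ u → u) (elt M a)) (aug-elt M a)
      φa-dg : (λ j → elt N (φ a) j - elt N (d ⊙ g) j) ≡[ N ] (λ j → - (+ d * g j - Frob N d g j))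
      φa-dg j j<N = trans (cong₂ _-_ (trans (elt-φ a j j<N) (sym (Frob-lift (elt M a) j)))
                                     (trans (elt-* N (+ d) g j) (cong (+ d *_) (elt-self n₀ g aug-g j j<N))))
                          (swap-sign (Frob N d g j) (+ d * g j))

    -- every d·g is hit: φ(reduce g) = F g ≡ d g
    onto-d· : ∀ g → Σ[ a ∈ Coeffs ] elt N (φ a) ≈[ N , εN ] elt N (d ⊙ g)
    onto-d· g = a , span-resp {G = εN} φa-dg (span-neg {G = εN} (span-d-Frob n₀ d P (aug-elt N g)))
      where
      P : Elt
      P = elt N g
      a : Coeffs
      a = reduce P
      aug-a : ∑ M a ≡ + 0
      aug-a = trans (aug-push N M (λ u → u) P) (aug-elt N g)
      φa-dg : (λ j → elt N (φ a) j - elt N (d ⊙ g) j) ≡[ N ] (λ j → - (+ d * P j - Frob N d P j))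
      φa-dg j j<N = trans (cong₂ _-_ (trans (elt-φ a j j<N)
                                       (trans (push-cong M N (d ℕ.*_) (elt-self m₁ a aug-a) j) (ι-reduce P j)))
                                     (elt-* N (+ d) g j))
                          (swap-sign (Frob N d P j) (+ d * P j))

    iso : MultipleIso m₁ n₀ d εM εN
    iso = record { φ = φ ; additive = additive ; well-defined = well-defined ; injective = injective
                 ; into-k· = into-d· ; onto-k· = onto-d· }

  module S-Comparison where

    fN fM : ℕ → Elt
    fN = fElt N d
    fM = fElt M d

    φ : Coeffs → Coeffs
    φ a = Spread d M N (elt M a)

    elt-φ : ∀ a → elt N (φ a) ≡[ N ] φ a
    elt-φ a = elt-self n₀ (φ a)
      (trans (aug-Spread d M N (elt M a)) (trans (cong (+ d *_) (aug-elt M a)) (ℤP.*-zeroʳ (+ d))))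

    additive : ∀ a a' v → φ (a ⊕ a') v ≡ φ a v + φ a' v
    additive a a' v = trans (Spread-cong d M N (λ y _ → elt-+ M a a' y) v) (Spread-+ d M N (elt M a) (elt M a') v)

    ht : ℕ → ℕ → ℕ
    ht t u = d ℕ.* u ℕ.+ t

    -- Spread_{M→N} f_v = Σ_{t<d} f_{dv+t}:  both are  d Σ_t x^{dv+t} - Σ_{t,t'} x^{d(dv+t')+t}
    Spread-f : ∀ v j → Spread d M N (fM v) j ≡ ∑ d (λ t → fN (d ℕ.* v ℕ.+ t) j)
    Spread-f v j = begin
      ∑ d (λ t → push M N (λ u → d ℕ.* u ℕ.+ t) (fM v) j)
        ≡⟨ ∑-ext d push-term ⟩
      ∑ d (λ t → + d * X N (d ℕ.* v ℕ.+ t) j - ∑ d (λ t' → X N (d ℕ.* (d ℕ.* v ℕ.+ t') ℕ.+ t) j))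
        ≡⟨ ∑-- d (λ t → + d * X N (d ℕ.* v ℕ.+ t) j) (λ t → ∑ d (λ t' → X N (d ℕ.* (d ℕ.* v ℕ.+ t') ℕ.+ t) j)) ⟩
      ∑ d (λ t → + d * X N (d ℕ.* v ℕ.+ t) j) - ∑ d (λ t → ∑ d (λ t' → X N (d ℕ.* (d ℕ.* v ℕ.+ t') ℕ.+ t) j))
        ≡⟨ cong (_-_ (∑ d (λ t → + d * X N (d ℕ.* v ℕ.+ t) j))) (∑-swap d d (λ t t' → X N (d ℕ.* (d ℕ.* v ℕ.+ t') ℕ.+ t) j)) ⟩
      ∑ d (λ t → + d * X N (d ℕ.* v ℕ.+ t) j) - ∑ d (λ t → ∑ d (λ t' → X N (d ℕ.* (d ℕ.* v ℕ.+ t) ℕ.+ t') j))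
        ≡⟨ ∑-- d (λ t → + d * X N (d ℕ.* v ℕ.+ t) j) (λ t → ∑ d (λ t' → X N (d ℕ.* (d ℕ.* v ℕ.+ t) ℕ.+ t') j)) ⟨
      ∑ d (λ t → fN (d ℕ.* v ℕ.+ t) j) ∎
      where
      open ≡-Reasoning
      push-X' : ∀ v t → push M N (λ u → d ℕ.* u ℕ.+ t) (X M v) j ≡ X N (d ℕ.* v ℕ.+ t) j
      push-X' v t = trans (push-X M N (λ u → d ℕ.* u ℕ.+ t) v j) (cong (λ z → δ z j) (affine-%-compat d v t M N N∣dM))
      push-term : ∀ t → push M N (λ u → d ℕ.* u ℕ.+ t) (fM v) j
                      ≡ + d * X N (d ℕ.* v ℕ.+ t) j - ∑ d (λ t' → X N (d ℕ.* (d ℕ.* v ℕ.+ t') ℕ.+ t) j)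
      push-term t =
        trans (push-- M N (ht t) (λ y → + d * X M v y) (λ y → ∑ d (λ t' → X M (d ℕ.* v ℕ.+ t') y)) j)
              (cong₂ _-_ (trans (push-* M N (ht t) (+ d) (X M v) j) (cong (+ d *_) (push-X' v t)))
                         (trans (push-∑ M N (ht t) d (λ t' → X M (d ℕ.* v ℕ.+ t')) j) (∑-ext d (λ t' → push-X' (d ℕ.* v ℕ.+ t') t))))

    well-defined : ∀ a a' → elt M a ≈[ M , fM ] elt M a' → elt N (φ a) ≈[ N , fN ] elt N (φ a')
    well-defined a a' (k , a≈a') = span-resp {G = fN} φ-diff≡
      (span-∑ {G = fN} m₁ (λ u → k (suc u)) (λ u j → ∑ d (λ t → fN (d ℕ.* suc u ℕ.+ t) j))
         (λ u _ → span-∑1 {G = fN} d (λ t → fN (d ℕ.* suc u ℕ.+ t)) (λ t _ → span-f n₀ d (d ℕ.* suc u ℕ.+ t))))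
      where
      open ≡-Reasoning
      w : Elt
      w y = elt M a y - elt M a' y
      φ-diff≡ : (λ j → elt N (φ a) j - elt N (φ a') j) ≡[ N ] (λ j → ∑ m₁ (λ u → k (suc u) * ∑ d (λ t → fN (d ℕ.* suc u ℕ.+ t) j)))
      φ-diff≡ j j<N = begin
        elt N (φ a) j - elt N (φ a') j ≡⟨ cong₂ _-_ (elt-φ a j j<N) (elt-φ a' j j<N) ⟩
        φ a j - φ a' j                 ≡⟨ Spread-- d M N (elt M a) (elt M a') j ⟨
        Spread d M N w j               ≡⟨ Spread-cong d M N a≈a' j ⟩
        ∑ d (λ t → push M N (ht t) (comb M fM k) j)
          ≡⟨ ∑-ext d (λ t → push-lin M N (ht t) m₁ (λ u → k (suc u)) (λ u → fM (suc u)) j) ⟩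
        ∑ d (λ t → ∑ m₁ (λ u → k (suc u) * push M N (ht t) (fM (suc u)) j))
          ≡⟨ ∑-swap d m₁ (λ t u → k (suc u) * push M N (ht t) (fM (suc u)) j) ⟩
        ∑ m₁ (λ u → ∑ d (λ t → k (suc u) * push M N (ht t) (fM (suc u)) j))
          ≡⟨ ∑-ext m₁ (λ u → trans (∑-*ˡ d (k (suc u)) (λ t → push M N (ht t) (fM (suc u)) j)) (cong (k (suc u) *_) (Spread-f (suc u) j))) ⟩
        ∑ m₁ (λ u → k (suc u) * ∑ d (λ t → fN (d ℕ.* suc u ℕ.+ t) j)) ∎

    -- Injectivity: apply Δ to reduce to the descent lemma, then integrate back.
    injective : ∀ a a' → elt N (φ a) ≈[ N , fN ] elt N (φ a') → elt M a ≈[ M , fM ] elt M a'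
    injective a a' (k , φa≈φa') = span-resp {G = fM} w≡LB (span-L m₁ d B)
      where
      open ≡-Reasoning
      w q : Elt
      w y = elt M a y - elt M a' y
      q zero    = + 0
      q (suc v) = k (suc v)
      Spread-w : Spread d M N w ≡[ N ] (λ j → + d * q j - Spread d N N q j)
      Spread-w j j<N = begin
        Spread d M N w j                ≡⟨ Spread-- d M N (elt M a) (elt M a') j ⟩
        φ a j - φ a' j                  ≡⟨ cong₂ _-_ (elt-φ a j j<N) (elt-φ a' j j<N) ⟨
        elt N (φ a) j - elt N (φ a') j  ≡⟨ φa≈φa' j j<N ⟩
        comb N fN k j                   ≡⟨ ℤP.+-identityˡ _ ⟨
        + 0 + comb N fN k j             ≡⟨ cong (_+ comb N fN k j) (ℤP.*-zeroˡ (fN 0 j)) ⟨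
        ∑ N (λ v → q v * fN v j)        ≡⟨ comb-f n₀ d q j j<N ⟨
        + d * q j - Spread d N N q j    ∎
      ιΔw≡ : ι (Δ M w) ≡[ N ] (λ j → + d * Δ N q j - Frob N d (Δ N q) j)
      ιΔw≡ j j<N = begin
        ι (Δ M w) j                                ≡⟨ Δ-Spread d M N N∣dM w j ⟨
        Δ N (Spread d M N w) j                     ≡⟨ Δ-cong N Spread-w j j<N ⟩
        Δ N (λ y → + d * q y - Spread d N N q y) j ≡⟨ Δ-L n₀ d q j ⟩
        + d * Δ N q j - Frob N d (Δ N q) j         ∎
      open Descent (Δ M w) (Δ N q) ιΔw≡
      aug-b : ∑ M b ≡ + 0
      aug-b = begin
        ∑ M b         ≡⟨ aug-push M N (d ℕ.*_) b ⟨
        ∑ N (ι b)     ≡⟨ ∑-cong N q≡ιb ⟨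
        ∑ N (Δ N q)   ≡⟨ aug-Δ N q ⟩
        + 0           ∎
      -- integrate b:  Δ B = b, so  Δ (w - L B) = (d - F₁) b - (d - F₁) b = 0
      B R : Elt
      B u = - ∑ (suc u) b
      R y = w y - (+ d * B y - Spread d M M B y)
      ΔR≡0 : Δ M R ≡[ M ] (λ _ → + 0)
      ΔR≡0 j j<M = begin
        Δ M R j                                         ≡⟨ Δ-- M w (λ y → + d * B y - Spread d M M B y) j ⟩
        Δ M w j - Δ M (λ y → + d * B y - Spread d M M B y) j ≡⟨ cong₂ _-_ (w≡ j j<M) (Δ-L m₁ d B j) ⟩
        (+ d * b j - Frob M d b j) - (+ d * Δ M B j - Frob M d (Δ M B) j)
          ≡⟨ cong₂ (λ x y → (+ d * b j - Frob M d b j) - (+ d * x - y))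
                   (integrate m₁ b aug-b j j<M) (push-cong M M (d ℕ.*_) (integrate m₁ b aug-b) j) ⟩
        (+ d * b j - Frob M d b j) - (+ d * b j - Frob M d b j) ≡⟨ ℤP.+-inverseʳ (+ d * b j - Frob M d b j) ⟩
        + 0                                             ∎
      aug-R : ∑ M R ≡ + 0
      aug-R = begin
        ∑ M R                                             ≡⟨ ∑-- M w (λ y → + d * B y - Spread d M M B y) ⟩
        ∑ M w - ∑ M (λ y → + d * B y - Spread d M M B y)
          ≡⟨ cong₂ _-_ (trans (∑-- M (elt M a) (elt M a')) (cong₂ _-_ (aug-elt M a) (aug-elt M a')))
                       (trans (∑-- M (λ y → + d * B y) (Spread d M M B)) (cong₂ _-_ (∑-*ˡ M (+ d) B) (aug-Spread d M M B))) ⟩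
        + 0 - + 0 - (+ d * ∑ M B - + d * ∑ M B)           ≡⟨ cong (_-_ (+ 0 - + 0)) (ℤP.+-inverseʳ (+ d * ∑ M B)) ⟩
        + 0                                               ∎
      w≡LB : w ≡[ M ] (λ y → + d * B y - Spread d M M B y)
      w≡LB j j<M = ℤP.i-j≡0⇒i≡j (w j) _ (Δ-kernel-aug m₁ R ΔR≡0 aug-R j j<M)

    -- φ(a) = Spread_N(lift a) ≡ d·lift(a) modulo L
    into-d· : ∀ a → Σ[ g ∈ Coeffs ] elt N (φ a) ≈[ N , fN ] elt N (d ⊙ g)
    into-d· a = g , span-resp {G = fN} φa-dg (span-neg {G = fN} (span-L n₀ d g))
      where
      g : Coeffs
      g = lift (elt M a)
      aug-g : ∑ N g ≡ + 0
      aug-g = trans (aug-push M N (λ u → u) (elt M a)) (aug-elt M a)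
      φa-dg : (λ j → elt N (φ a) j - elt N (d ⊙ g) j) ≡[ N ] (λ j → - (+ d * g j - Spread d N N g j))
      φa-dg j j<N = trans (cong₂ _-_ (trans (elt-φ a j j<N) (sym (Spread-reduce d M N N (elt M a) (divides d refl) j)))
                                     (trans (elt-* N (+ d) g j) (cong (+ d *_) (elt-self n₀ g aug-g j j<N))))
                          (swap-sign (Spread d N N g j) (+ d * g j))

    -- every d·g is hit: φ(reduce g) = Spread_N g ≡ d g
    onto-d· : ∀ g → Σ[ a ∈ Coeffs ] elt N (φ a) ≈[ N , fN ] elt N (d ⊙ g)
    onto-d· g = a , span-resp {G = fN} φa-dg (span-neg {G = fN} (span-L n₀ d P))
      where
      P : Elt
      P = elt N g
      a : Coeffs
      a = reduce P
      aug-a : ∑ M a ≡ + 0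
      aug-a = trans (aug-push N M (λ u → u) P) (aug-elt N g)
      φa-dg : (λ j → elt N (φ a) j - elt N (d ⊙ g) j) ≡[ N ] (λ j → - (+ d * P j - Spread d N N P j))
      φa-dg j j<N = trans (cong₂ _-_ (trans (elt-φ a j j<N)
                                       (trans (Spread-cong d M N (elt-self m₁ a aug-a) j) (Spread-reduce d N M N P N∣dM j)))
                                     (elt-* N (+ d) g j))
                          (swap-sign (Spread d N N P j) (+ d * P j))

    iso : MultipleIso m₁ n₀ d fM fN
    iso = record { φ = φ ; additive = additive ; well-defined = well-defined ; injective = injective
                 ; into-k· = into-d· ; onto-k· = onto-d· }

theorem4p1 : (n d n₁ : ℕ) → 1 ≤ n → 2 ≤ d → n₁ ℕ.* gcd n d ≡ n →
    IsoOntoMultiple (≈Σ n₁ d) d (≈Σ n d) × IsoOntoMultiple (≈S n₁ d) d (≈S n d)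
theorem4p1 (suc n₀) (suc (suc d₂)) zero     (s≤s z≤n) (s≤s (s≤s z≤n)) ()
theorem4p1 (suc n₀) (suc (suc d₂)) (suc m₁) (s≤s z≤n) (s≤s (s≤s z≤n)) n₁g≡n =
    multiple-iso m₁ n₀ d (ε M d) (εElt M d) (ε N d) (εElt N d) (ε-εElt m₁ d) (ε-εElt n₀ d) Σ-Comparison.iso
  , multiple-iso m₁ n₀ d (f M d) (fElt M d) (f N d) (fElt N d) (f-fElt m₁ d) (f-fElt n₀ d) S-Comparison.iso
  where
  open Comparison n₀ m₁ (suc d₂) (proj₁ (gcd-arithmetic n₀ (suc d₂) (suc m₁) n₁g≡n))
                                 (proj₂ (gcd-arithmetic n₀ (suc d₂) (suc m₁) n₁g≡n))
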